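{- Let $G$ be a matrix over $\mathrm{GF}(2)$ of rank $r$ with column set $E$. For $k=0,\dots,5$ let $\mathcal{T}(k,6)$ be the set of triples $(f_1,f_2,f_3)$ of functions $f_j:E\to\mathrm{GF}(2)$ such that $f_1-f_2$ and $f_2-f_3$ lie in the row space of $G$ over $\mathrm{GF}(2)$ and $|\mathrm{supp}(f_1)|+|\mathrm{supp}(f_2)|+|\mathrm{supp}(f_3)|\equiv k\pmod6$. Write $T_k=|\mathcal{T}(k,6)|$. If $|E|$ is even, then $$T_0+T_1-T_3-T_4=(-3)^{|E|/2}\chi(M(G);4)\quad\text{and}\quad T_1+T_2-T_4-T_5=0.$$ If $|E|$ is odd, then $$\tfrac12[T_1+T_2-T_4-T_5]=T_0+T_1-T_3-T_4=(-3)^{(|E|-1)/2}\chi(M(G);4)$$ and $$T_0+\tfrac12T_1-\tfrac12T_2-T_3-\tfrac12T_4+\tfrac12T_5=0.$$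
   Context: $\mathrm{supp}(f)=\{e: f(e)\ne0\}$. $M(G)$ is the matroid on $E$ of linear dependence of the columns of $G$, with rank function $\mathrm{rk}$ and rank $r$; $\chi(M;\lambda)=\sum_{B\subseteq E}(-1)^{|B|}\lambda^{r-\mathrm{rk}(B)}$ is its characteristic polynomial. -}

module Defs where

open import Data.Bool using (Bool; true; false; _xor_; _∧_; _∨_; not; if_then_else_)
open import Data.Nat using (ℕ; zero; suc; _+_; _∸_; _⊔_; _%_; _≡ᵇ_)
open import Data.Fin using (Fin; zero; suc)
open import Data.List using (List; []; _∷_; concatMap; map; foldr)
open import Data.Integer as ℤ using (ℤ; +_)
open import Function using (_∘_)

-- GF(2) is modelled by Bool: addition = _xor_, multiplication = _∧_.
-- A matrix over GF(2) with m rows and column set E = Fin n.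
Matrix : ℕ → ℕ → Set
Matrix m n = Fin m → Fin n → Bool

allB : ∀ {n} → (Fin n → Bool) → Bool
allB {zero} p = true
allB {suc n} p = p zero ∧ allB (p ∘ suc)

anyB : ∀ {n} → (Fin n → Bool) → Bool
anyB {zero} p = false
anyB {suc n} p = p zero ∨ anyB (p ∘ suc)

xsum : ∀ {n} → (Fin n → Bool) → Bool
xsum {zero} p = false
xsum {suc n} p = p zero xor xsum (p ∘ suc)

suppSize : ∀ {n} → (Fin n → Bool) → ℕ
suppSize {zero} f = 0
suppSize {suc n} f = (if f zero then 1 else 0) + suppSize (f ∘ suc)

cons : ∀ {n} → Bool → (Fin n → Bool) → Fin (suc n) → Bool
cons b f zero = b
cons b f (suc i) = f i

allFuns : (n : ℕ) → List (Fin n → Bool)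
allFuns zero = (λ ()) ∷ []
allFuns (suc n) = concatMap (λ f → cons false f ∷ cons true f ∷ []) (allFuns n)

anyL : ∀ {A : Set} → (A → Bool) → List A → Bool
anyL p = foldr (λ x b → p x ∨ b) false

allL : ∀ {A : Set} → (A → Bool) → List A → Bool
allL p = foldr (λ x b → p x ∧ b) true

sumℕ : ∀ {A : Set} → (A → ℕ) → List A → ℕ
sumℕ f = foldr (λ x s → f x + s) 0

sumℤ : ∀ {A : Set} → (A → ℤ) → List A → ℤ
sumℤ f = foldr (λ x s → f x ℤ.+ s) (+ 0)

maxℕ : ∀ {A : Set} → (A → ℕ) → List A → ℕ
maxℕ f = foldr (λ x s → f x ⊔ s) 0

inRowSpace : ∀ {m n} → Matrix m n → (Fin n → Bool) → Bool
inRowSpace {m} G f =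
  anyL (λ c → allB (λ e → not (f e xor xsum (λ i → c i ∧ G i e)))) (allFuns m)

-- The matroid M(G): linear dependence of the columns of G over GF(2).
-- Subsets of E are functions E → Bool.
subsetB : ∀ {n} → (Fin n → Bool) → (Fin n → Bool) → Bool
subsetB T S = allB (λ e → not (T e) ∨ S e)

colSum : ∀ {m n} → Matrix m n → (Fin n → Bool) → Fin m → Bool
colSum G T i = xsum (λ e → T e ∧ G i e)

independent : ∀ {m n} → Matrix m n → (Fin n → Bool) → Bool
independent {m} {n} G S =
  allL (λ T → not (subsetB T S ∧ anyB T) ∨ anyB (colSum G T)) (allFuns n)

rk : ∀ {m n} → Matrix m n → (Fin n → Bool) → ℕ
rk {m} {n} G B =
  maxℕ (λ S → if subsetB S B ∧ independent G S then suppSize S else 0) (allFuns n)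

rank : ∀ {m n} → Matrix m n → ℕ
rank G = rk G (λ _ → true)

χ : ∀ {m n} → Matrix m n → ℤ → ℤ
χ {m} {n} G λ' =
  sumℤ (λ B → (ℤ.- (+ 1)) ℤ.^ suppSize B ℤ.* (λ' ℤ.^ (rank G ∸ rk G B))) (allFuns n)

inT : ∀ {m n} → Matrix m n → ℕ → (Fin n → Bool) → (Fin n → Bool) → (Fin n → Bool) → Bool
inT G k f₁ f₂ f₃ =
  inRowSpace G (λ e → f₁ e xor f₂ e) ∧ inRowSpace G (λ e → f₂ e xor f₃ e)
  ∧ (((suppSize f₁ + suppSize f₂ + suppSize f₃) % 6) ≡ᵇ k)

T : ∀ {m n} → Matrix m n → ℕ → ℕ
T {m} {n} G k =
  sumℕ (λ f₁ → sumℕ (λ f₂ → sumℕ (λ f₃ → if inT G k f₁ f₂ f₃ then 1 else 0)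
    (allFuns n)) (allFuns n)) (allFuns n)

Tℤ : ∀ {m n} → Matrix m n → ℕ → ℤ
Tℤ G k = + T G k

module Submission where

-- Let ω = e^{iπ/3}, so ω^k depends only on k mod 6 and ℤ[ω] = ℤ ⊕ ℤω with ω² = ω - 1.  The sum
-- S = Σ ω^{|f₁|+|f₂|+|f₃|} over the triples counted by the T_k is Σ_k T_k ω^k, with coordinates
-- T₀ - T₂ - T₃ + T₅ and T₁ + T₂ - T₄ - T₅.  Writing f₂ = f₁ + c₁G, f₃ = f₂ + c₂G, where each
-- row-space vector is cG for K = 2^{m-r} vectors c, gives K²S = Σ_{c₁,c₂} Σ_f ω^{|f|+|f+u|+|f+u+v|}
-- with u = c₁G, v = c₂G.  The inner sum factors over coordinates: it is ρⁿ (ρ = -1 + 2ω = √-3)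
-- if u, v have no common zero and 0 otherwise.  Inclusion-exclusion over the common zero set B
-- counts these pairs as Σ_B (-1)^{|B|} W_B² with W_B = #{c : cG vanishes on B} = 2^{m - rk B},
-- i.e. 4^{m-r} χ(M(G); 4).  So S = χ(M(G); 4) ρⁿ, and ρⁿ = (-3)^h or (-3)^h ρ gives the corollary.

open import Defs
open import Data.Nat using (ℕ; _+_; _*_)
open import Data.Integer as ℤ using (ℤ; +_; -[1+_])
open import Data.Product using (_×_)
open import Relation.Binary.PropositionalEquality using (_≡_)

open import Data.Bool using (Bool; true; false; _xor_; _∧_; _∨_; not; if_then_else_)
open import Data.Bool.Properties using (∧-assoc; xor-comm; xor-identityʳ; ∧-distribˡ-xor; ∧-distribʳ-xor; xor-∧-commutativeRing)
open import Algebra.Bundles using (CommutativeRing)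
open import Data.Empty using (⊥; ⊥-elim)
open import Data.Fin using (Fin; zero; suc)
open import Data.Fin.Properties using (_≟_)
open import Data.List using (List; []; _∷_; _++_; concatMap; foldr; upTo; allFin)
open import Data.List.Membership.Propositional using (_∈_)
open import Data.List.Membership.Propositional.Properties using (∈-allFin)
open import Data.List.Relation.Unary.Any using (here; there)
open import Data.List.Relation.Unary.Any.Properties using (++⁺ʳ)
open import Data.Nat using (zero; suc; _^_; _≤_; _<_; _∸_; z≤n; s≤s; _%_; _≡ᵇ_; ≢-nonZero)
open import Data.Nat.DivMod using (_/_; m≡m%n+[m/n]*n; m%n<n)
import Data.Nat.Properties as ℕP
import Data.Nat.Tactic.RingSolver as ℕSolver
import Data.Integer.Properties as ℤP
open import Data.Integer.Tactic.RingSolver using (solve-∀)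
open import Data.Product using (Σ; _,_; proj₁; proj₂)
open import Function using (_∘_)
open import Relation.Binary.PropositionalEquality using (refl; sym; trans; cong; cong₂; subst; _≗_; module ≡-Reasoning)
open import Relation.Nullary using (does; yes; no)

module GF2 = CommutativeRing xor-∧-commutativeRing
open import Algebra.Properties.CommutativeSemigroup GF2.+-commutativeSemigroup
  using () renaming (interchange to xor-interchange; x∙yz≈y∙xz to xor-swapˡ)
open import Algebra.Properties.CommutativeSemigroup GF2.*-commutativeSemigroup
  using () renaming (x∙yz≈y∙xz to ∧-swapˡ)

-- A commutative semiring whose equality is propositional equality.  It is instantiated with ℤ
-- and with the Eisenstein integers, so that every manipulation of finite sums is proved once.
record CommSemiring≡ : Set₁ where
  infixl 6 _⊕_
  infixl 7 _⊛_
  field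
    Carrier : Set
    _⊕_ _⊛_ : Carrier → Carrier → Carrier
    0# 1# : Carrier
    +-assoc : ∀ x y z → (x ⊕ y) ⊕ z ≡ x ⊕ (y ⊕ z)
    +-comm : ∀ x y → x ⊕ y ≡ y ⊕ x
    +-identityˡ : ∀ x → 0# ⊕ x ≡ x
    *-assoc : ∀ x y z → (x ⊛ y) ⊛ z ≡ x ⊛ (y ⊛ z)
    *-comm : ∀ x y → x ⊛ y ≡ y ⊛ x
    *-identityˡ : ∀ x → 1# ⊛ x ≡ x
    distribʳ : ∀ x y z → (y ⊕ z) ⊛ x ≡ y ⊛ x ⊕ z ⊛ x
    zeroˡ : ∀ x → 0# ⊛ x ≡ 0#

Bits : ℕ → Set
Bits n = Fin n → Bool

-- A property of vectors that only depends on their values (allFuns lists functions, which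
-- are compared pointwise).
Resp : ∀ {n} {B : Set} → (Bits n → B) → Set
Resp {n} p = ∀ {f g : Bits n} → f ≗ g → p f ≡ p g

cons-cong : ∀ {n} b {f g : Bits n} → f ≗ g → cons b f ≗ cons b g
cons-cong b eq zero = refl
cons-cong b eq (suc i) = eq i

cons-split : ∀ {n} (g : Bits (suc n)) → cons (g zero) (g ∘ suc) ≗ g
cons-split g zero = refl
cons-split g (suc i) = refl

module FiniteSums (R : CommSemiring≡) where
  open CommSemiring≡ R public

  ∑ : {A : Set} → (A → Carrier) → List A → Carrier
  ∑ f = foldr (λ x s → f x ⊕ s) 0#

  ∏ : ∀ {n} → (Fin n → Carrier) → Carrier
  ∏ {zero} f = 1#
  ∏ {suc n} f = f zero ⊛ ∏ (f ∘ suc)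

  [_] : Bool → Carrier
  [ true ] = 1#
  [ false ] = 0#

  [∧] : ∀ a b → [ a ∧ b ] ≡ [ a ] ⊛ [ b ]
  [∧] true b = sym (*-identityˡ _)
  [∧] false b = sym (zeroˡ _)

  +-identityʳ : ∀ x → x ⊕ 0# ≡ x
  +-identityʳ x = trans (+-comm x 0#) (+-identityˡ x)

  *-identityʳ : ∀ x → x ⊛ 1# ≡ x
  *-identityʳ x = trans (*-comm x 1#) (*-identityˡ x)

  zeroʳ : ∀ x → x ⊛ 0# ≡ 0#
  zeroʳ x = trans (*-comm x 0#) (zeroˡ x)

  distribˡ : ∀ x y z → x ⊛ (y ⊕ z) ≡ x ⊛ y ⊕ x ⊛ z
  distribˡ x y z = trans (*-comm x (y ⊕ z)) (trans (distribʳ x y z) (cong₂ _⊕_ (*-comm y x) (*-comm z x)))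

  *-swapˡ : ∀ x y z → x ⊛ (y ⊛ z) ≡ y ⊛ (x ⊛ z)
  *-swapˡ x y z = trans (sym (*-assoc x y z)) (trans (cong (_⊛ z) (*-comm x y)) (*-assoc y x z))

  +-interchange : ∀ a b c d → (a ⊕ b) ⊕ (c ⊕ d) ≡ (a ⊕ c) ⊕ (b ⊕ d)
  +-interchange a b c d = begin
      (a ⊕ b) ⊕ (c ⊕ d) ≡⟨ +-assoc a b (c ⊕ d) ⟩
      a ⊕ (b ⊕ (c ⊕ d)) ≡⟨ cong (a ⊕_) (sym (+-assoc b c d)) ⟩
      a ⊕ ((b ⊕ c) ⊕ d) ≡⟨ cong (λ t → a ⊕ (t ⊕ d)) (+-comm b c) ⟩
      a ⊕ ((c ⊕ b) ⊕ d) ≡⟨ cong (a ⊕_) (+-assoc c b d) ⟩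
      a ⊕ (c ⊕ (b ⊕ d)) ≡⟨ sym (+-assoc a c (b ⊕ d)) ⟩
      (a ⊕ c) ⊕ (b ⊕ d) ∎
    where open ≡-Reasoning

  *-interchange : ∀ a b x y → (a ⊛ x) ⊛ (b ⊛ y) ≡ (a ⊛ b) ⊛ (x ⊛ y)
  *-interchange a b x y = begin
      (a ⊛ x) ⊛ (b ⊛ y) ≡⟨ *-assoc a x (b ⊛ y) ⟩
      a ⊛ (x ⊛ (b ⊛ y)) ≡⟨ cong (a ⊛_) (*-swapˡ x b y) ⟩
      a ⊛ (b ⊛ (x ⊛ y)) ≡⟨ sym (*-assoc a b (x ⊛ y)) ⟩
      (a ⊛ b) ⊛ (x ⊛ y) ∎
    where open ≡-Reasoning

  infixr 8 _^ⁿ_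
  _^ⁿ_ : Carrier → ℕ → Carrier
  x ^ⁿ zero = 1#
  x ^ⁿ suc k = x ⊛ x ^ⁿ k

  ^ⁿ-+ : ∀ x a b → x ^ⁿ (a + b) ≡ x ^ⁿ a ⊛ x ^ⁿ b
  ^ⁿ-+ x zero b = sym (*-identityˡ _)
  ^ⁿ-+ x (suc a) b = trans (cong (x ⊛_) (^ⁿ-+ x a b)) (sym (*-assoc x _ _))

  ^ⁿ-* : ∀ x a b → x ^ⁿ (a * b) ≡ (x ^ⁿ b) ^ⁿ a
  ^ⁿ-* x zero b = refl
  ^ⁿ-* x (suc a) b = trans (^ⁿ-+ x b (a * b)) (cong (x ^ⁿ b ⊛_) (^ⁿ-* x a b))

  1^ⁿ : ∀ k → 1# ^ⁿ k ≡ 1#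
  1^ⁿ zero = refl
  1^ⁿ (suc k) = trans (*-identityˡ _) (1^ⁿ k)

  sum-cong : {A : Set} {f g : A → Carrier} → (∀ x → f x ≡ g x) → ∀ l → ∑ f l ≡ ∑ g l
  sum-cong eq [] = refl
  sum-cong eq (x ∷ l) = cong₂ _⊕_ (eq x) (sum-cong eq l)

  sum-zero : {A : Set} (l : List A) → ∑ (λ _ → 0#) l ≡ 0#
  sum-zero [] = refl
  sum-zero (x ∷ l) = trans (+-identityˡ _) (sum-zero l)

  sum-+ : {A : Set} (f g : A → Carrier) → ∀ l → ∑ (λ x → f x ⊕ g x) l ≡ ∑ f l ⊕ ∑ g l
  sum-+ f g [] = sym (+-identityˡ 0#)
  sum-+ f g (x ∷ l) = trans (cong (f x ⊕ g x ⊕_) (sum-+ f g l)) (+-interchange (f x) (g x) _ _)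

  sum-*ˡ : {A : Set} (c : Carrier) (f : A → Carrier) → ∀ l → ∑ (λ x → c ⊛ f x) l ≡ c ⊛ ∑ f l
  sum-*ˡ c f [] = sym (zeroʳ c)
  sum-*ˡ c f (x ∷ l) = trans (cong (c ⊛ f x ⊕_) (sum-*ˡ c f l)) (sym (distribˡ c (f x) _))

  sum-*ʳ : {A : Set} (c : Carrier) (f : A → Carrier) → ∀ l → ∑ (λ x → f x ⊛ c) l ≡ ∑ f l ⊛ c
  sum-*ʳ c f l = trans (sum-cong (λ x → *-comm (f x) c) l) (trans (sum-*ˡ c f l) (*-comm c _))

  sum-++ : {A : Set} (f : A → Carrier) (l₁ l₂ : List A) → ∑ f (l₁ ++ l₂) ≡ ∑ f l₁ ⊕ ∑ f l₂
  sum-++ f [] l₂ = sym (+-identityˡ _)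
  sum-++ f (x ∷ l₁) l₂ = trans (cong (f x ⊕_) (sum-++ f l₁ l₂)) (sym (+-assoc _ _ _))

  sum-swap : {A B : Set} (f : A → B → Carrier) (l₁ : List A) (l₂ : List B) →
    ∑ (λ x → ∑ (f x) l₂) l₁ ≡ ∑ (λ y → ∑ (λ x → f x y) l₁) l₂
  sum-swap f [] l₂ = sym (sum-zero l₂)
  sum-swap f (x ∷ l₁) l₂ = trans (cong (∑ (f x) l₂ ⊕_) (sum-swap f l₁ l₂))
                             (sym (sum-+ (f x) (λ y → ∑ (λ x → f x y) l₁) l₂))

  sum-split : ∀ {n} (f : Bits (suc n) → Carrier) →
    ∑ f (allFuns (suc n)) ≡ ∑ (λ g → f (cons false g) ⊕ f (cons true g)) (allFuns n)
  sum-split {n} f = go (allFuns n)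
    where
    go : ∀ l → ∑ f (concatMap (λ g → cons false g ∷ cons true g ∷ []) l)
             ≡ ∑ (λ g → f (cons false g) ⊕ f (cons true g)) l
    go [] = refl
    go (g ∷ l) = trans (sum-++ f (cons false g ∷ cons true g ∷ []) (concatMap (λ g → cons false g ∷ cons true g ∷ []) l))
                   (cong₂ _⊕_ (cong (f (cons false g) ⊕_) (+-identityʳ _)) (go l))

  prod-expand : ∀ {n} (a b : Fin n → Carrier) →
    ∏ (λ i → a i ⊕ b i) ≡ ∑ (λ T → ∏ (λ i → if T i then b i else a i)) (allFuns n)
  prod-expand {zero} a b = sym (+-identityʳ 1#)
  prod-expand {suc n} a b = begin
      (a zero ⊕ b zero) ⊛ ∏ (λ i → a (suc i) ⊕ b (suc i))
        ≡⟨ cong ((a zero ⊕ b zero) ⊛_) (prod-expand (a ∘ suc) (b ∘ suc)) ⟩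
      (a zero ⊕ b zero) ⊛ ∑ P (allFuns n)
        ≡⟨ sym (sum-*ˡ _ P (allFuns n)) ⟩
      ∑ (λ T → (a zero ⊕ b zero) ⊛ P T) (allFuns n)
        ≡⟨ sum-cong (λ T → distribʳ (P T) (a zero) (b zero)) (allFuns n) ⟩
      ∑ (λ T → a zero ⊛ P T ⊕ b zero ⊛ P T) (allFuns n)
        ≡⟨ sym (sum-split (λ T → ∏ (λ i → if T i then b i else a i))) ⟩
      ∑ (λ T → ∏ (λ i → if T i then b i else a i)) (allFuns (suc n)) ∎
    where
    open ≡-Reasoning
    P : Bits n → Carrier
    P T = ∏ (λ i → if T i then b (suc i) else a (suc i))

  prod-indicator : ∀ {n} (p : Bits n) x → ∏ (λ e → [ p e ] ⊛ x) ≡ [ allB p ] ⊛ x ^ⁿ n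
  prod-indicator {zero} p x = sym (*-identityˡ 1#)
  prod-indicator {suc n} p x = begin
      ([ p zero ] ⊛ x) ⊛ ∏ (λ e → [ p (suc e) ] ⊛ x)
        ≡⟨ cong (([ p zero ] ⊛ x) ⊛_) (prod-indicator (p ∘ suc) x) ⟩
      ([ p zero ] ⊛ x) ⊛ ([ allB (p ∘ suc) ] ⊛ x ^ⁿ n)
        ≡⟨ *-interchange [ p zero ] [ allB (p ∘ suc) ] x (x ^ⁿ n) ⟩
      ([ p zero ] ⊛ [ allB (p ∘ suc) ]) ⊛ x ^ⁿ suc n
        ≡⟨ cong (_⊛ x ^ⁿ suc n) (sym ([∧] (p zero) (allB (p ∘ suc)))) ⟩
      [ allB p ] ⊛ x ^ⁿ suc n ∎
    where open ≡-Reasoning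

  pick : ∀ b (Z : Bool → Carrier) → [ not (false xor b) ] ⊛ Z false ⊕ [ not (true xor b) ] ⊛ Z true ≡ Z b
  pick false Z = trans (cong₂ _⊕_ (*-identityˡ _) (zeroˡ _)) (+-identityʳ _)
  pick true Z = trans (cong₂ _⊕_ (zeroˡ _) (*-identityˡ _)) (+-identityˡ _)

  sum-delta : ∀ {n} (F : Bits n → Carrier) → Resp F → ∀ g →
    ∑ (λ f → [ allB (λ e → not (f e xor g e)) ] ⊛ F f) (allFuns n) ≡ F g
  sum-delta {zero} F rF g = trans (+-identityʳ _) (trans (*-identityˡ _) (rF (λ ())))
  sum-delta {suc n} F rF g = begin
      ∑ (λ f → [ δ f g ] ⊛ F f) (allFuns (suc n))
        ≡⟨ sum-split (λ f → [ δ f g ] ⊛ F f) ⟩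
      ∑ (λ h → [ δ (cons false h) g ] ⊛ F (cons false h) ⊕ [ δ (cons true h) g ] ⊛ F (cons true h)) (allFuns n)
        ≡⟨ sum-cong (λ h → trans (cong₂ _⊕_ (factor false h) (factor true h))
                                  (pick (g zero) (λ b → [ δ h (g ∘ suc) ] ⊛ F (cons b h)))) (allFuns n) ⟩
      ∑ (λ h → [ δ h (g ∘ suc) ] ⊛ F (cons (g zero) h)) (allFuns n)
        ≡⟨ sum-delta (λ h → F (cons (g zero) h)) (λ eq → rF (cons-cong (g zero) eq)) (g ∘ suc) ⟩
      F (cons (g zero) (g ∘ suc))
        ≡⟨ rF (cons-split g) ⟩
      F g ∎
    where
    open ≡-Reasoning
    δ : ∀ {k} → Bits k → Bits k → Bool
    δ f g = allB (λ e → not (f e xor g e))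
    factor : ∀ b h → [ δ (cons b h) g ] ⊛ F (cons b h) ≡ [ not (b xor g zero) ] ⊛ ([ δ h (g ∘ suc) ] ⊛ F (cons b h))
    factor b h = trans (cong (_⊛ F (cons b h)) ([∧] (not (b xor g zero)) (δ h (g ∘ suc)))) (*-assoc _ _ _)

  sum-translate : ∀ {m} (F : Bits m → Carrier) → Resp F → ∀ (d : Bits m) →
    ∑ (λ c → F (λ i → c i xor d i)) (allFuns m) ≡ ∑ F (allFuns m)
  sum-translate {zero} F rF d = cong (_⊕ 0#) (rF (λ ()))
  sum-translate {suc m} F rF d = begin
      ∑ (λ c → F (λ i → c i xor d i)) (allFuns (suc m))
        ≡⟨ sum-split (λ c → F (λ i → c i xor d i)) ⟩
      ∑ (λ g → F (λ i → cons false g i xor d i) ⊕ F (λ i → cons true g i xor d i)) (allFuns m)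
        ≡⟨ sum-cong (λ g → cong₂ _⊕_ (rF (shift false g)) (rF (shift true g))) (allFuns m) ⟩
      ∑ (λ g → F₀ (false xor d zero) (g +d) ⊕ F₀ (true xor d zero) (g +d)) (allFuns m)
        ≡⟨ sum-+ (λ g → F₀ (false xor d zero) (g +d)) (λ g → F₀ (true xor d zero) (g +d)) (allFuns m) ⟩
      ∑ (λ g → F₀ (false xor d zero) (g +d)) (allFuns m) ⊕ ∑ (λ g → F₀ (true xor d zero) (g +d)) (allFuns m)
        ≡⟨ cong₂ _⊕_ (sum-translate (F₀ (false xor d zero)) (rF₀ _) (d ∘ suc))
                     (sum-translate (F₀ (true xor d zero)) (rF₀ _) (d ∘ suc)) ⟩
      ∑ (F₀ (false xor d zero)) (allFuns m) ⊕ ∑ (F₀ (true xor d zero)) (allFuns m)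
        ≡⟨ flip (d zero) ⟩
      ∑ (F₀ false) (allFuns m) ⊕ ∑ (F₀ true) (allFuns m)
        ≡⟨ sym (sum-+ (F₀ false) (F₀ true) (allFuns m)) ⟩
      ∑ (λ g → F₀ false g ⊕ F₀ true g) (allFuns m)
        ≡⟨ sym (sum-split F) ⟩
      ∑ F (allFuns (suc m)) ∎
    where
    open ≡-Reasoning
    _+d : Bits m → Bits m
    (g +d) i = g i xor d (suc i)
    F₀ : Bool → Bits m → Carrier
    F₀ b g = F (cons b g)
    rF₀ : ∀ b → Resp (F₀ b)
    rF₀ b eq = rF (cons-cong b eq)
    shift : ∀ b g → (λ i → cons b g i xor d i) ≗ cons (b xor d zero) (g +d)
    shift b g zero = refl
    shift b g (suc i) = refl
    flip : ∀ b → ∑ (F₀ (false xor b)) (allFuns m) ⊕ ∑ (F₀ (true xor b)) (allFuns m)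
                 ≡ ∑ (F₀ false) (allFuns m) ⊕ ∑ (F₀ true) (allFuns m)
    flip false = refl
    flip true = +-comm _ _

∧-true₁ : ∀ {a b} → a ∧ b ≡ true → a ≡ true
∧-true₁ {true} _ = refl

∧-true₂ : ∀ {a b} → a ∧ b ≡ true → b ≡ true
∧-true₂ {true} e = e

t≢f : true ≡ false → ⊥
t≢f ()

allB-cong : ∀ {n} {p q : Bits n} → p ≗ q → allB p ≡ allB q
allB-cong {zero} eq = refl
allB-cong {suc n} eq = cong₂ _∧_ (eq zero) (allB-cong (eq ∘ suc))

anyB-cong : ∀ {n} {p q : Bits n} → p ≗ q → anyB p ≡ anyB q
anyB-cong {zero} eq = refl
anyB-cong {suc n} eq = cong₂ _∨_ (eq zero) (anyB-cong (eq ∘ suc))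

xsum-cong : ∀ {n} {p q : Bits n} → p ≗ q → xsum p ≡ xsum q
xsum-cong {zero} eq = refl
xsum-cong {suc n} eq = cong₂ _xor_ (eq zero) (xsum-cong (eq ∘ suc))

suppSize-cong : ∀ {n} {p q : Bits n} → p ≗ q → suppSize p ≡ suppSize q
suppSize-cong {zero} eq = refl
suppSize-cong {suc n} eq = cong₂ _+_ (cong (λ b → if b then 1 else 0) (eq zero)) (suppSize-cong (eq ∘ suc))

allB-elim : ∀ {n} {p : Bits n} → allB p ≡ true → ∀ i → p i ≡ true
allB-elim {suc n} {p} e zero = ∧-true₁ e
allB-elim {suc n} {p} e (suc i) = allB-elim (∧-true₂ {p zero} e) i

allB-intro : ∀ {n} {p : Bits n} → (∀ i → p i ≡ true) → allB p ≡ true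
allB-intro {zero} h = refl
allB-intro {suc n} {p} h rewrite h zero = allB-intro (h ∘ suc)

anyB-elim : ∀ {n} {p : Bits n} → anyB p ≡ true → Σ (Fin n) (λ i → p i ≡ true)
anyB-elim {suc n} {p} e with p zero in eq
... | true = zero , eq
... | false = let (i , q) = anyB-elim {n} {p ∘ suc} e in suc i , q

anyB-false : ∀ {n} {p : Bits n} → anyB p ≡ false → ∀ i → p i ≡ false
anyB-false {suc n} {p} e i with p zero in eq
anyB-false {suc n} {p} e zero | false = eq
anyB-false {suc n} {p} e (suc i) | false = anyB-false e i
anyB-false {suc n} {p} () i | true

anyB⇒¬allB-not : ∀ {n} {p : Bits n} → anyB p ≡ true → allB (λ i → not (p i)) ≡ false
anyB⇒¬allB-not {suc n} {p} e with p zero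
... | true = refl
... | false = anyB⇒¬allB-not {n} {p ∘ suc} e

xsum-zero : ∀ {n} → xsum {n} (λ _ → false) ≡ false
xsum-zero {zero} = refl
xsum-zero {suc n} = xsum-zero {n}

xsum-xor : ∀ {n} (f g : Bits n) → xsum (λ i → f i xor g i) ≡ xsum f xor xsum g
xsum-xor {zero} f g = refl
xsum-xor {suc n} f g = trans (cong ((f zero xor g zero) xor_) (xsum-xor (f ∘ suc) (g ∘ suc)))
                             (xor-interchange (f zero) (g zero) _ _)

xsum-∧ˡ : ∀ {n} a (f : Bits n) → a ∧ xsum f ≡ xsum (λ i → a ∧ f i)
xsum-∧ˡ {zero} true f = refl
xsum-∧ˡ {zero} false f = refl
xsum-∧ˡ {suc n} a f = trans (∧-distribˡ-xor a (f zero) _) (cong ((a ∧ f zero) xor_) (xsum-∧ˡ a (f ∘ suc)))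

xsum-swap : ∀ {m n} (f : Fin m → Fin n → Bool) →
  xsum (λ i → xsum (λ j → f i j)) ≡ xsum (λ j → xsum (λ i → f i j))
xsum-swap {zero} {n} f = sym (xsum-zero {n})
xsum-swap {suc m} {n} f = trans (cong (xsum (f zero) xor_) (xsum-swap (f ∘ suc)))
                                (sym (xsum-xor (f zero) (λ j → xsum (λ i → f (suc i) j))))

unit : ∀ {n} → Fin n → Bits n
unit e x = does (x ≟ e)

unit-sound : ∀ {n} {x e : Fin n} → unit e x ≡ true → x ≡ e
unit-sound {x = x} {e} u with x ≟ e
... | yes x≡e = x≡e
... | no _ = ⊥-elim (t≢f (sym u))

xsum-unit : ∀ {n} (f : Bits n) e → xsum (λ x → unit e x ∧ f x) ≡ f e
xsum-unit {suc n} f zero = trans (cong (f zero xor_) (xsum-zero {n})) (xor-identityʳ (f zero))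
xsum-unit {suc n} f (suc e) = xsum-unit (f ∘ suc) e

xsum-pick : ∀ {n} (f : Bits n) e → xsum f ≡ f e xor xsum (λ x → not (unit e x) ∧ f x)
xsum-pick {suc n} f zero = refl
xsum-pick {suc n} f (suc e) = trans (cong (f zero xor_) (xsum-pick (f ∘ suc) e))
                                    (xor-swapˡ (f zero) (f (suc e)) _)

∈-concat : ∀ {n} (b : Bool) {g : Bits n} {l : List (Bits n)} → g ∈ l →
  cons b g ∈ concatMap (λ f → cons false f ∷ cons true f ∷ []) l
∈-concat false (here refl) = here refl
∈-concat true (here refl) = there (here refl)
∈-concat b {l = x ∷ l} (there p) = ++⁺ʳ (cons false x ∷ cons true x ∷ []) (∈-concat b p)

∈-allFuns : ∀ {n} (g : Bits n) → Σ (Bits n) (λ f → f ∈ allFuns n × f ≗ g)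
∈-allFuns {zero} g = (λ ()) , here refl , λ ()
∈-allFuns {suc n} g with ∈-allFuns {n} (g ∘ suc)
... | f , mem , eq = cons (g zero) f , ∈-concat (g zero) mem ,
                     λ i → trans (cons-cong (g zero) eq i) (cons-split g i)

anyL-intro : ∀ {A : Set} {p : A → Bool} {x} {l} → x ∈ l → p x ≡ true → anyL p l ≡ true
anyL-intro {p = p} {l = y ∷ l} (here refl) e rewrite e = refl
anyL-intro {p = p} {l = y ∷ l} (there m) e with p y
... | true = refl
... | false = anyL-intro m e

anyL-elim : ∀ {A : Set} {p : A → Bool} l → anyL p l ≡ true → Σ A (λ x → x ∈ l × p x ≡ true)
anyL-elim {p = p} (y ∷ l) e with p y in eq
... | true = y , here refl , eq
... | false = let (x , m , q) = anyL-elim l e in x , there m , q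

allL-elim : ∀ {A : Set} {p : A → Bool} {x} {l} → allL p l ≡ true → x ∈ l → p x ≡ true
allL-elim {p = p} {l = y ∷ l} e (here refl) = ∧-true₁ e
allL-elim {p = p} {l = y ∷ l} e (there m) = allL-elim (∧-true₂ {p y} e) m

allL-intro : ∀ {A : Set} {p : A → Bool} l → (∀ {x} → x ∈ l → p x ≡ true) → allL p l ≡ true
allL-intro [] h = refl
allL-intro (y ∷ l) h rewrite h (here refl) = allL-intro l (h ∘ there)

anyAll-intro : ∀ {n} {p : Bits n → Bool} → Resp p → ∀ g → p g ≡ true → anyL p (allFuns n) ≡ true
anyAll-intro rp g e with ∈-allFuns g
... | f , m , eq = anyL-intro m (trans (rp eq) e)

allAll-elim : ∀ {n} {p : Bits n → Bool} → Resp p → allL p (allFuns n) ≡ true → ∀ g → p g ≡ true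
allAll-elim rp e g with ∈-allFuns g
... | f , m , eq = trans (sym (rp eq)) (allL-elim e m)

ℤ-semiring : CommSemiring≡
ℤ-semiring = record
  { Carrier = ℤ ; _⊕_ = ℤ._+_ ; _⊛_ = ℤ._*_ ; 0# = + 0 ; 1# = + 1
  ; +-assoc = ℤP.+-assoc ; +-comm = ℤP.+-comm ; +-identityˡ = ℤP.+-identityˡ
  ; *-assoc = ℤP.*-assoc ; *-comm = ℤP.*-comm ; *-identityˡ = ℤP.*-identityˡ
  ; distribʳ = ℤP.*-distribʳ-+ ; zeroˡ = ℤP.*-zeroˡ }

module ℤΣ = FiniteSums ℤ-semiring
open ℤΣ using () renaming (∑ to ∑ℤ; ∏ to ∏ℤ; [_] to [_]ℤ)

sumℕ-ℤ : ∀ {A : Set} (f : A → ℕ) l → + sumℕ f l ≡ ∑ℤ (λ x → + f x) l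
sumℕ-ℤ f [] = refl
sumℕ-ℤ f (x ∷ l) = trans (ℤP.pos-+ (f x) (sumℕ f l)) (cong (λ t → (+ f x) ℤ.+ t) (sumℕ-ℤ f l))

count-ℤ : ∀ {A : Set} (p : A → Bool) l → + sumℕ (λ x → if p x then 1 else 0) l ≡ ∑ℤ (λ x → [ p x ]ℤ) l
count-ℤ p l = trans (sumℕ-ℤ _ l) (ℤΣ.sum-cong (λ x → indicator (p x)) l)
  where
  indicator : ∀ b → + (if b then 1 else 0) ≡ [ b ]ℤ
  indicator true = refl
  indicator false = refl

-- Linear algebra over GF(2) attached to the matrix G.

rowComb : ∀ {m n} → Matrix m n → Bits m → Bits n
rowComb G c e = xsum (λ i → c i ∧ G i e)

dot : ∀ {m} → Bits m → Bits m → Bool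
dot c v = xsum (λ i → c i ∧ v i)

isZero : ∀ {m} → Bits m → Bool
isZero v = allB (λ i → not (v i))

dot-colSum : ∀ {m n} (G : Matrix m n) (T : Bits n) (c : Bits m) →
  xsum (λ e → T e ∧ rowComb G c e) ≡ dot c (colSum G T)
dot-colSum G T c = begin
    xsum (λ e → T e ∧ rowComb G c e)
      ≡⟨ xsum-cong (λ e → xsum-∧ˡ (T e) (λ i → c i ∧ G i e)) ⟩
    xsum (λ e → xsum (λ i → T e ∧ (c i ∧ G i e)))
      ≡⟨ xsum-swap (λ e i → T e ∧ (c i ∧ G i e)) ⟩
    xsum (λ i → xsum (λ e → T e ∧ (c i ∧ G i e)))
      ≡⟨ xsum-cong (λ i → trans (xsum-cong (λ e → ∧-swapˡ (T e) (c i) (G i e)))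
                               (sym (xsum-∧ˡ (c i) (λ e → T e ∧ G i e)))) ⟩
    dot c (colSum G T) ∎
  where open ≡-Reasoning

rowComb-xor : ∀ {m n} (G : Matrix m n) (c d : Bits m) e →
  rowComb G (λ i → c i xor d i) e ≡ rowComb G c e xor rowComb G d e
rowComb-xor G c d e = trans (xsum-cong (λ i → ∧-distribʳ-xor (G i e) (c i) (d i)))
                            (xsum-xor (λ i → c i ∧ G i e) (λ i → d i ∧ G i e))

rowComb-cong : ∀ {m n} (G : Matrix m n) {c d : Bits m} → c ≗ d → ∀ e → rowComb G c e ≡ rowComb G d e
rowComb-cong G eq e = xsum-cong (λ i → cong (_∧ G i e) (eq i))

colSum-cong : ∀ {m n} (G : Matrix m n) {T T' : Bits n} → T ≗ T' → ∀ i → colSum G T i ≡ colSum G T' i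
colSum-cong G eq i = xsum-cong (λ e → cong (_∧ G i e) (eq e))

subset-elim : ∀ {n} (T S : Bits n) → subsetB T S ≡ true → ∀ x → T x ≡ true → S x ≡ true
subset-elim T S e x t with allB-elim e x
... | q rewrite t = q

subset-intro : ∀ {n} {T S : Bits n} → (∀ x → T x ≡ true → S x ≡ true) → subsetB T S ≡ true
subset-intro {T = T} {S} h = allB-intro λ x → imp (T x) (S x) (h x)
  where
  imp : ∀ a b → (a ≡ true → b ≡ true) → not a ∨ b ≡ true
  imp true b f = f refl
  imp false b f = refl

subset-cong : ∀ {n} {T T' S : Bits n} → T ≗ T' → subsetB T S ≡ subsetB T' S
subset-cong {S = S} eq = allB-cong (λ x → cong (λ b → not b ∨ S x) (eq x))

independencePred : ∀ {m n} → Matrix m n → Bits n → Bits n → Bool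
independencePred G S T = not (subsetB T S ∧ anyB T) ∨ anyB (colSum G T)

indep-elim : ∀ {m n} (G : Matrix m n) {S : Bits n} → independent G S ≡ true →
  ∀ T → subsetB T S ≡ true → anyB T ≡ true → anyB (colSum G T) ≡ true
indep-elim G {S} ind T s a with allAll-elim resp ind T
  where
  resp : Resp (independencePred G S)
  resp eq = cong₂ (λ a b → not a ∨ b) (cong₂ _∧_ (subset-cong eq) (anyB-cong eq))
                  (anyB-cong (colSum-cong G eq))
... | q rewrite s | a = q

indep-intro : ∀ {m n} (G : Matrix m n) {S : Bits n} →
  (∀ T → subsetB T S ≡ true → anyB T ≡ true → anyB (colSum G T) ≡ true) → independent G S ≡ true
indep-intro {n = n} G {S} h = allL-intro (allFuns n) (λ {T} _ → holds T)
  where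
  holds : ∀ T → independencePred G S T ≡ true
  holds T with subsetB T S in e₁ | anyB T in e₂
  ... | false | b = refl
  ... | true | false = refl
  ... | true | true = h T e₁ e₂

-- Characters of GF(2)^m and the number W_S of row combinations vanishing on S.

sign : Bool → ℤ
sign true = -[1+ 0 ]
sign false = + 1

sign-xor : ∀ a b → sign (a xor b) ≡ sign a ℤ.* sign b
sign-xor true true = refl
sign-xor true false = refl
sign-xor false b = sym (ℤP.*-identityˡ _)

character-sum : ∀ {m} (v : Bits m) → ∑ℤ (λ c → sign (dot c v)) (allFuns m) ≡ + (2 ^ m) ℤ.* [ isZero v ]ℤ
character-sum {zero} v = refl
character-sum {suc m} v = trans (ℤΣ.sum-split (λ c → sign (dot c v))) (by-first-entry (v zero))
  where
  d : Bits m → Bool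
  d c = dot c (v ∘ suc)
  by-first-entry : ∀ b → ∑ℤ (λ g → sign (d g) ℤ.+ sign (b xor d g)) (allFuns m)
                         ≡ + (2 ^ suc m) ℤ.* [ not b ∧ isZero (v ∘ suc) ]ℤ
  by-first-entry false = begin
      ∑ℤ (λ g → sign (d g) ℤ.+ sign (d g)) (allFuns m)
        ≡⟨ ℤΣ.sum-cong (λ g → sym (double (sign (d g)))) (allFuns m) ⟩
      ∑ℤ (λ g → + 2 ℤ.* sign (d g)) (allFuns m)
        ≡⟨ ℤΣ.sum-*ˡ (+ 2) (λ g → sign (d g)) (allFuns m) ⟩
      + 2 ℤ.* ∑ℤ (λ g → sign (d g)) (allFuns m)
        ≡⟨ cong (+ 2 ℤ.*_) (character-sum (v ∘ suc)) ⟩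
      + 2 ℤ.* (+ (2 ^ m) ℤ.* [ isZero (v ∘ suc) ]ℤ)
        ≡⟨ sym (ℤP.*-assoc (+ 2) (+ (2 ^ m)) _) ⟩
      (+ 2 ℤ.* + (2 ^ m)) ℤ.* [ isZero (v ∘ suc) ]ℤ
        ≡⟨ cong (ℤ._* [ isZero (v ∘ suc) ]ℤ) (sym (ℤP.pos-* 2 (2 ^ m))) ⟩
      + (2 ^ suc m) ℤ.* [ isZero (v ∘ suc) ]ℤ ∎
    where
    open ≡-Reasoning
    double : ∀ x → + 2 ℤ.* x ≡ x ℤ.+ x
    double = solve-∀
  by-first-entry true = trans (ℤΣ.sum-cong (λ g → cancel (d g)) (allFuns m))
                              (trans (ℤΣ.sum-zero (allFuns m)) (sym (ℤP.*-zeroʳ (+ (2 ^ suc m)))))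
    where
    cancel : ∀ b → sign b ℤ.+ sign (true xor b) ≡ + 0
    cancel true = refl
    cancel false = refl

vanishesOn : ∀ {m n} → Matrix m n → Bits n → Bits m → Bool
vanishesOn G B c = allB (λ e → not (B e) ∨ not (rowComb G c e))

vanishCount : ∀ {m n} → Matrix m n → Bits n → ℕ
vanishCount {m} G B = sumℕ (λ c → if vanishesOn G B c then 1 else 0) (allFuns m)

prod-vanishing : ∀ {n} (S r : Bits n) →
  ∏ℤ (λ e → + 1 ℤ.+ [ S e ]ℤ ℤ.* sign (r e)) ≡ + (2 ^ suppSize S) ℤ.* [ allB (λ e → not (S e) ∨ not (r e)) ]ℤ
prod-vanishing {zero} S r = refl
prod-vanishing {suc n} S r with S zero | r zero
... | false | _ = trans (ℤP.*-identityˡ _) (prod-vanishing (S ∘ suc) (r ∘ suc))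
... | true | true = trans (ℤP.*-zeroˡ (∏ℤ (λ e → + 1 ℤ.+ [ S (suc e) ]ℤ ℤ.* sign (r (suc e)))))
                          (sym (ℤP.*-zeroʳ (+ (2 ^ (1 + suppSize (S ∘ suc))))))
... | true | false = begin
    + 2 ℤ.* ∏ℤ (λ e → + 1 ℤ.+ [ S (suc e) ]ℤ ℤ.* sign (r (suc e)))
      ≡⟨ cong (+ 2 ℤ.*_) (prod-vanishing (S ∘ suc) (r ∘ suc)) ⟩
    + 2 ℤ.* (+ (2 ^ suppSize (S ∘ suc)) ℤ.* I)
      ≡⟨ sym (ℤP.*-assoc (+ 2) (+ (2 ^ suppSize (S ∘ suc))) I) ⟩
    (+ 2 ℤ.* + (2 ^ suppSize (S ∘ suc))) ℤ.* I
      ≡⟨ cong (ℤ._* I) (sym (ℤP.pos-* 2 (2 ^ suppSize (S ∘ suc)))) ⟩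
    + (2 ^ suc (suppSize (S ∘ suc))) ℤ.* I ∎
  where
  open ≡-Reasoning
  I = [ allB (λ e → not (S (suc e)) ∨ not (r (suc e))) ]ℤ

prod-subset : ∀ {n} (T S r : Bits n) →
  ∏ℤ (λ e → if T e then [ S e ]ℤ ℤ.* sign (r e) else + 1) ≡ [ subsetB T S ]ℤ ℤ.* sign (xsum (λ e → T e ∧ r e))
prod-subset {zero} T S r = refl
prod-subset {suc n} T S r with T zero | S zero
... | false | _ = trans (ℤP.*-identityˡ _) (prod-subset (T ∘ suc) (S ∘ suc) (r ∘ suc))
... | true | false = refl
... | true | true = begin
    (+ 1 ℤ.* sign (r zero)) ℤ.* ∏ℤ (λ e → if T (suc e) then [ S (suc e) ]ℤ ℤ.* sign (r (suc e)) else + 1)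
      ≡⟨ cong₂ ℤ._*_ (ℤP.*-identityˡ (sign (r zero))) (prod-subset (T ∘ suc) (S ∘ suc) (r ∘ suc)) ⟩
    sign (r zero) ℤ.* ([ I ]ℤ ℤ.* sign X)
      ≡⟨ ℤΣ.*-swapˡ (sign (r zero)) [ I ]ℤ (sign X) ⟩
    [ I ]ℤ ℤ.* (sign (r zero) ℤ.* sign X)
      ≡⟨ cong ([ I ]ℤ ℤ.*_) (sym (sign-xor (r zero) X)) ⟩
    [ I ]ℤ ℤ.* sign (r zero xor X) ∎
  where
  open ≡-Reasoning
  I = subsetB (T ∘ suc) (S ∘ suc)
  X = xsum (λ e → T (suc e) ∧ r (suc e))

kernelCount : ∀ {m n} → Matrix m n → Bits n → ℤ
kernelCount {n = n} G S = ∑ℤ (λ T → [ subsetB T S ]ℤ ℤ.* [ isZero (colSum G T) ]ℤ) (allFuns n)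

-- Expand
-- 2^{|S|}[cG vanishes on S] = ∏_e (1 + [e ∈ S](-1)^{(cG)_e}) into a sum over T ⊆ S, swap the
-- sums over c and T, and apply orthogonality of characters.
vanishCount-duality : ∀ {m n} (G : Matrix m n) (S : Bits n) →
  + (2 ^ suppSize S) ℤ.* + vanishCount G S ≡ + (2 ^ m) ℤ.* kernelCount G S
vanishCount-duality {m} {n} G S = begin
    + (2 ^ suppSize S) ℤ.* + vanishCount G S
      ≡⟨ cong (+ (2 ^ suppSize S) ℤ.*_) (count-ℤ (vanishesOn G S) (allFuns m)) ⟩
    + (2 ^ suppSize S) ℤ.* ∑ℤ (λ c → [ vanishesOn G S c ]ℤ) (allFuns m)
      ≡⟨ sym (ℤΣ.sum-*ˡ (+ (2 ^ suppSize S)) (λ c → [ vanishesOn G S c ]ℤ) (allFuns m)) ⟩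
    ∑ℤ (λ c → + (2 ^ suppSize S) ℤ.* [ vanishesOn G S c ]ℤ) (allFuns m)
      ≡⟨ ℤΣ.sum-cong (λ c → sym (prod-vanishing S (rowComb G c))) (allFuns m) ⟩
    ∑ℤ (λ c → ∏ℤ (λ e → + 1 ℤ.+ [ S e ]ℤ ℤ.* sign (rowComb G c e))) (allFuns m)
      ≡⟨ ℤΣ.sum-cong (λ c → trans (ℤΣ.prod-expand (λ _ → + 1) (λ e → [ S e ]ℤ ℤ.* sign (rowComb G c e)))
                                   (ℤΣ.sum-cong (term c) (allFuns n))) (allFuns m) ⟩
    ∑ℤ (λ c → ∑ℤ (λ T → [ subsetB T S ]ℤ ℤ.* sign (dot c (colSum G T))) (allFuns n)) (allFuns m)
      ≡⟨ ℤΣ.sum-swap (λ c T → [ subsetB T S ]ℤ ℤ.* sign (dot c (colSum G T))) (allFuns m) (allFuns n) ⟩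
    ∑ℤ (λ T → ∑ℤ (λ c → [ subsetB T S ]ℤ ℤ.* sign (dot c (colSum G T))) (allFuns m)) (allFuns n)
      ≡⟨ ℤΣ.sum-cong orthogonality (allFuns n) ⟩
    ∑ℤ (λ T → + (2 ^ m) ℤ.* ([ subsetB T S ]ℤ ℤ.* [ isZero (colSum G T) ]ℤ)) (allFuns n)
      ≡⟨ ℤΣ.sum-*ˡ (+ (2 ^ m)) (λ T → [ subsetB T S ]ℤ ℤ.* [ isZero (colSum G T) ]ℤ) (allFuns n) ⟩
    + (2 ^ m) ℤ.* kernelCount G S ∎
  where
  open ≡-Reasoning
  term : ∀ c T → ∏ℤ (λ e → if T e then [ S e ]ℤ ℤ.* sign (rowComb G c e) else + 1)
                 ≡ [ subsetB T S ]ℤ ℤ.* sign (dot c (colSum G T))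
  term c T = trans (prod-subset T S (rowComb G c)) (cong (λ b → [ subsetB T S ]ℤ ℤ.* sign b) (dot-colSum G T c))
  orthogonality : ∀ T → ∑ℤ (λ c → [ subsetB T S ]ℤ ℤ.* sign (dot c (colSum G T))) (allFuns m)
                        ≡ + (2 ^ m) ℤ.* ([ subsetB T S ]ℤ ℤ.* [ isZero (colSum G T) ]ℤ)
  orthogonality T = begin
      ∑ℤ (λ c → [ subsetB T S ]ℤ ℤ.* sign (dot c (colSum G T))) (allFuns m)
        ≡⟨ ℤΣ.sum-*ˡ [ subsetB T S ]ℤ (λ c → sign (dot c (colSum G T))) (allFuns m) ⟩
      [ subsetB T S ]ℤ ℤ.* ∑ℤ (λ c → sign (dot c (colSum G T))) (allFuns m)
        ≡⟨ cong ([ subsetB T S ]ℤ ℤ.*_) (character-sum (colSum G T)) ⟩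
      [ subsetB T S ]ℤ ℤ.* (+ (2 ^ m) ℤ.* [ isZero (colSum G T) ]ℤ)
        ≡⟨ ℤΣ.*-swapˡ [ subsetB T S ]ℤ (+ (2 ^ m)) [ isZero (colSum G T) ]ℤ ⟩
      + (2 ^ m) ℤ.* ([ subsetB T S ]ℤ ℤ.* [ isZero (colSum G T) ]ℤ) ∎

count-empty : ∀ {n} → ∑ℤ (λ T → [ not (anyB {n} T) ]ℤ) (allFuns n) ≡ + 1
count-empty {zero} = refl
count-empty {suc n} = trans (ℤΣ.sum-split {n} (λ T → [ not (anyB T) ]ℤ))
   (trans (ℤΣ.sum-cong (λ g → ℤΣ.+-identityʳ [ not (anyB g) ]ℤ) (allFuns n)) (count-empty {n}))

-- For independent S the only column relation inside S is the empty one: Z_S = 1.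
kernelCount-independent : ∀ {m n} (G : Matrix m n) (S : Bits n) → independent G S ≡ true → kernelCount G S ≡ + 1
kernelCount-independent {n = n} G S ind = trans (ℤΣ.sum-cong only-empty (allFuns n)) (count-empty {n})
  where
  only-empty : ∀ T → [ subsetB T S ]ℤ ℤ.* [ isZero (colSum G T) ]ℤ ≡ [ not (anyB T) ]ℤ
  only-empty T with anyB T in e
  ... | false rewrite subset-intro {T = T} {S} (λ x t → ⊥-elim (t≢f (trans (sym t) (anyB-false e x))))
                    | allB-intro {p = λ i → not (colSum G T i)}
                        (λ i → cong not (trans (xsum-cong (λ x → cong (_∧ G i x) (anyB-false e x))) (xsum-zero {n}))) = refl
  ... | true with subsetB T S in e₂
  ...   | false = ℤP.*-zeroˡ [ isZero (colSum G T) ]ℤ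
  ...   | true = cong (λ b → [ true ]ℤ ℤ.* [ b ]ℤ) (anyB⇒¬allB-not {p = colSum G T} (indep-elim G ind T e₂ e))

vanishCount-independent : ∀ {m n} (G : Matrix m n) (S : Bits n) → independent G S ≡ true →
  2 ^ suppSize S * vanishCount G S ≡ 2 ^ m
vanishCount-independent {m} G S ind = ℤP.+-injective (begin
    + (2 ^ suppSize S * vanishCount G S)     ≡⟨ ℤP.pos-* (2 ^ suppSize S) (vanishCount G S) ⟩
    + (2 ^ suppSize S) ℤ.* + vanishCount G S ≡⟨ vanishCount-duality G S ⟩
    + (2 ^ m) ℤ.* kernelCount G S            ≡⟨ cong (+ (2 ^ m) ℤ.*_) (kernelCount-independent G S ind) ⟩
    + (2 ^ m) ℤ.* + 1                        ≡⟨ ℤP.*-identityʳ (+ (2 ^ m)) ⟩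
    + (2 ^ m) ∎)
  where open ≡-Reasoning

-- A greedy basis of B, giving 2^{rk B} W_B = 2^m for every B ⊆ E.

_⊆_ : ∀ {n} → Bits n → Bits n → Set
S ⊆ B = ∀ x → S x ≡ true → B x ≡ true

column : ∀ {m n} → Matrix m n → Fin n → Bits m
column G e i = G i e

InSpan : ∀ {m n} → Matrix m n → Bits n → Bits m → Set
InSpan {n = n} G S v = Σ (Bits n) (λ T → (subsetB T S ≡ true) × (∀ i → colSum G T i ≡ v i))

spanned : ∀ {m n} → Matrix m n → Bits n → Bits m → Bool
spanned {n = n} G S v = anyL (λ T → subsetB T S ∧ allB (λ i → not (colSum G T i xor v i))) (allFuns n)

not-xor⇒≡ : ∀ a b → not (a xor b) ≡ true → a ≡ b
not-xor⇒≡ true true _ = refl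
not-xor⇒≡ false false _ = refl

not-xor-self : ∀ a → not (a xor a) ≡ true
not-xor-self true = refl
not-xor-self false = refl

spanned-sound : ∀ {m n} (G : Matrix m n) S v → spanned G S v ≡ true → InSpan G S v
spanned-sound {n = n} G S v e with anyL-elim (allFuns n) e
... | T , _ , q = T , ∧-true₁ q ,
                  λ i → not-xor⇒≡ (colSum G T i) (v i) (allB-elim (∧-true₂ {subsetB T S} q) i)

spanned-complete : ∀ {m n} (G : Matrix m n) S v → InSpan G S v → spanned G S v ≡ true
spanned-complete G S v (T , sub , eq) = anyAll-intro resp T
  (trans (cong (_∧ _) sub)
         (allB-intro (λ i → subst (λ t → not (colSum G T i xor t) ≡ true) (eq i) (not-xor-self (colSum G T i)))))
  where
  resp : Resp (λ T → subsetB T S ∧ allB (λ i → not (colSum G T i xor v i)))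
  resp e = cong₂ _∧_ (subset-cong e) (allB-cong (λ i → cong (λ t → not (t xor v i)) (colSum-cong G e i)))

span-mono : ∀ {m n} (G : Matrix m n) {S S' : Bits n} {v} → S ⊆ S' → InSpan G S v → InSpan G S' v
span-mono G h (T , s , eq) = T , subset-intro (λ x t → h x (subset-elim T _ s x t)) , eq

insert : ∀ {n} → Fin n → Bits n → Bits n
insert e S x = S x ∨ unit e x

∨-false⇒ : ∀ a → a ∨ false ≡ true → a ≡ true
∨-false⇒ true _ = refl

insert-⊆ : ∀ {n} e (S : Bits n) → S ⊆ insert e S
insert-⊆ e S x s rewrite s = refl

column-spanned-by-insert : ∀ {m n} (G : Matrix m n) (S : Bits n) e → InSpan G (insert e S) (column G e)
column-spanned-by-insert G S e =
  unit e , subset-intro {T = unit e} {S = insert e S} (λ x u → trans (cong (S x ∨_) u) (∨-true (S x))) ,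
  (λ i → xsum-unit (G i) e)
  where
  ∨-true : ∀ a → a ∨ true ≡ true
  ∨-true true = refl
  ∨-true false = refl

avoiding-e-⊆ : ∀ {n} (e : Fin n) (S T : Bits n) → subsetB T (insert e S) ≡ true → T e ≡ false →
  subsetB T S ≡ true
avoiding-e-⊆ e S T sub te = subset-intro {T = T} {S = S} λ x t →
    ∨-false⇒ (S x) (subst (λ u → S x ∨ u ≡ true) (not-e x t) (subset-elim T (insert e S) sub x t))
  where
  not-e : ∀ x → T x ≡ true → unit e x ≡ false
  not-e x t with unit e x in u
  ... | false = refl
  ... | true = ⊥-elim (t≢f (trans (sym t) (trans (cong T (unit-sound u)) te)))

relation-through-e : ∀ {m n} (G : Matrix m n) (e : Fin n) (S T : Bits n) → subsetB T (insert e S) ≡ true →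
  T e ≡ true → anyB (colSum G T) ≡ false → InSpan G S (column G e)
relation-through-e G e S T sub te zero-sum = T' , subset-intro {T = T'} {S = S} in-S , sums-to-e
  where
  T' : Bits _
  T' x = not (unit e x) ∧ T x
  in-S : ∀ x → T' x ≡ true → S x ≡ true
  in-S x t with unit e x in u
  ... | false = ∨-false⇒ (S x) (trans (cong (S x ∨_) (sym u)) (subset-elim T (insert e S) sub x t))
  xor-zero⇒≡ : ∀ {a b} → a xor b ≡ false → b ≡ a
  xor-zero⇒≡ {true} {true} _ = refl
  xor-zero⇒≡ {false} {false} _ = refl
  sums-to-e : ∀ i → colSum G T' i ≡ G i e
  sums-to-e i = xor-zero⇒≡ (begin
      G i e xor colSum G T' i
        ≡⟨ cong (λ b → (b ∧ G i e) xor colSum G T' i) (sym te) ⟩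
      (T e ∧ G i e) xor colSum G T' i
        ≡⟨ cong ((T e ∧ G i e) xor_) (xsum-cong (λ x → GF2.*-assoc (not (unit e x)) (T x) (G i x))) ⟩
      (T e ∧ G i e) xor xsum (λ x → not (unit e x) ∧ (T x ∧ G i x))
        ≡⟨ sym (xsum-pick (λ x → T x ∧ G i x) e) ⟩
      colSum G T i
        ≡⟨ anyB-false zero-sum i ⟩
      false ∎)
    where open ≡-Reasoning

-- Exchange step: adjoining a column outside the span of an independent set S keeps it
-- independent, since a nonempty relation in S ∪ {e} either avoids e or spans column e by S.
insert-independent : ∀ {m n} (G : Matrix m n) (S : Bits n) (e : Fin n) → independent G S ≡ true →
  spanned G S (column G e) ≡ false → independent G (insert e S) ≡ true
insert-independent G S e ind unspanned = indep-intro G relation-nonzero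
  where
  relation-nonzero : ∀ T → subsetB T (insert e S) ≡ true → anyB T ≡ true → anyB (colSum G T) ≡ true
  relation-nonzero T sub ne with anyB (colSum G T) in zero-sum
  ... | true = refl
  ... | false with T e in te
  ...   | false = ⊥-elim (t≢f (trans (sym (indep-elim G ind T (avoiding-e-⊆ e S T sub te) ne)) zero-sum))
  ...   | true = ⊥-elim (t≢f (trans (sym (spanned-complete G S (column G e)
                                                (relation-through-e G e S T sub te zero-sum))) unspanned))

Greedy : ∀ {m n} → Matrix m n → Bits n → List (Fin n) → Bits n → Set
Greedy G B es S = (independent G S ≡ true) × (S ⊆ B) × (∀ e → e ∈ es → B e ≡ true → InSpan G S (column G e))

greedyStep : ∀ {m n} → Matrix m n → Bits n → Bits n → Fin n → Bits n
greedyStep G B S e = if B e ∧ not (spanned G S (column G e)) then insert e S else S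

greedy : ∀ {m n} → Matrix m n → Bits n → List (Fin n) → Bits n → Bits n
greedy G B [] S = S
greedy G B (e ∷ es) S = greedy G B es (greedyStep G B S e)

greedyStep-spec : ∀ {m n} (G : Matrix m n) (B S : Bits n) e → independent G S ≡ true → S ⊆ B →
  (independent G (greedyStep G B S e) ≡ true) × (greedyStep G B S e ⊆ B) × (S ⊆ greedyStep G B S e)
  × (B e ≡ true → InSpan G (greedyStep G B S e) (column G e))
greedyStep-spec G B S e ind S⊆B with B e in be | spanned G S (column G e) in sp
... | false | _ = ind , S⊆B , (λ x s → s) , λ ()
... | true | true = ind , S⊆B , (λ x s → s) , λ _ → spanned-sound G S (column G e) sp
... | true | false = insert-independent G S e ind sp , inserted⊆B , insert-⊆ e S , λ _ → column-spanned-by-insert G S e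
  where
  inserted⊆B : insert e S ⊆ B
  inserted⊆B x t with unit e x in u
  ... | true = trans (cong B (unit-sound u)) be
  ... | false = S⊆B x (∨-false⇒ (S x) t)

greedy-spec : ∀ {m n} (G : Matrix m n) (B : Bits n) es S → independent G S ≡ true → S ⊆ B →
  Greedy G B es (greedy G B es S) × (S ⊆ greedy G B es S)
greedy-spec G B [] S ind S⊆B = (ind , S⊆B , λ e ()) , λ x s → s
greedy-spec G B (e ∷ es) S ind S⊆B with greedyStep-spec G B S e ind S⊆B
... | ind₁ , sub₁ , grow₁ , span₁ with greedy-spec G B es (greedyStep G B S e) ind₁ sub₁
...   | (ind₂ , sub₂ , span₂) , grow₂ = (ind₂ , sub₂ , spans) , λ x s → grow₂ x (grow₁ x s)
  where
  spans : ∀ e' → e' ∈ e ∷ es → B e' ≡ true → InSpan G (greedy G B es (greedyStep G B S e)) (column G e')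
  spans e' (here refl) be = span-mono G grow₂ (span₁ be)
  spans e' (there m) be = span₂ e' m be

empty-independent : ∀ {m n} (G : Matrix m n) → independent G (λ _ → false) ≡ true
empty-independent G = indep-intro G (λ T s a → let (i , t) = anyB-elim a in ⊥-elim (t≢f (sym (subset-elim T (λ _ → false) s i t))))

basis : ∀ {m n} → Matrix m n → Bits n → Bits n
basis {n = n} G B = greedy G B (allFin n) (λ _ → false)

basis-spec : ∀ {m n} (G : Matrix m n) (B : Bits n) →
  (independent G (basis G B) ≡ true) × (basis G B ⊆ B) × (∀ e → B e ≡ true → InSpan G (basis G B) (column G e))
basis-spec {n = n} G B with greedy-spec G B (allFin n) (λ _ → false) (empty-independent G) (λ x ())
... | (ind , sub , span) , _ = ind , sub , λ e be → span e (∈-allFin e) be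

vanishesOn-antitone : ∀ {m n} (G : Matrix m n) {S B : Bits n} → S ⊆ B →
  ∀ c → vanishesOn G B c ≡ true → vanishesOn G S c ≡ true
vanishesOn-antitone G {S} {B} S⊆B c w = allB-intro on-S
  where
  on-S : ∀ e → not (S e) ∨ not (rowComb G c e) ≡ true
  on-S e with S e in se
  ... | false = refl
  ... | true with allB-elim w e
  ...   | q rewrite S⊆B e se = q

vanishCount-antitone : ∀ {m n} (G : Matrix m n) {S B : Bits n} → S ⊆ B → vanishCount G B ≤ vanishCount G S
vanishCount-antitone {m} G {S} {B} S⊆B = termwise (allFuns m)
  where
  indicator-mono : ∀ {a b : Bool} → (a ≡ true → b ≡ true) → (if a then 1 else 0) ≤ (if b then 1 else 0)
  indicator-mono {false} h = z≤n
  indicator-mono {true} h rewrite h refl = ℕP.≤-refl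
  termwise : ∀ l → sumℕ (λ c → if vanishesOn G B c then 1 else 0) l ≤ sumℕ (λ c → if vanishesOn G S c then 1 else 0) l
  termwise [] = z≤n
  termwise (c ∷ l) = ℕP.+-mono-≤ (indicator-mono (vanishesOn-antitone G S⊆B c)) (termwise l)

-- cG vanishes on B iff it vanishes on the basis of B, since the columns of B are sums of
-- basis columns.
vanishesOn-basis : ∀ {m n} (G : Matrix m n) (B : Bits n) c → vanishesOn G B c ≡ vanishesOn G (basis G B) c
vanishesOn-basis {n = n} G B c with basis-spec G B
... | _ , S⊆B , spans = bool-ext (vanishesOn-antitone G S⊆B c) on-B
  where
  S = basis G B
  bool-ext : ∀ {a b : Bool} → (a ≡ true → b ≡ true) → (b ≡ true → a ≡ true) → a ≡ b
  bool-ext {false} {false} _ _ = refl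
  bool-ext {false} {true} _ h = h refl
  bool-ext {true} h _ = sym (h refl)
  on-B : vanishesOn G S c ≡ true → vanishesOn G B c ≡ true
  on-B w = allB-intro on-e
    where
    zero-on-S : ∀ e → S e ≡ true → rowComb G c e ≡ false
    zero-on-S e s with allB-elim w e
    ... | q rewrite s = not-true q
      where
      not-true : ∀ {a} → not a ≡ true → a ≡ false
      not-true {false} _ = refl
    zero-on-T : ∀ (T : Bits n) → subsetB T S ≡ true → ∀ e → T e ∧ rowComb G c e ≡ false
    zero-on-T T T⊆S e with T e in t
    ... | false = refl
    ... | true = zero-on-S e (subset-elim T S T⊆S e t)
    on-e : ∀ e → not (B e) ∨ not (rowComb G c e) ≡ true
    on-e e with B e in be
    ... | false = refl
    ... | true with spans e be
    ...   | T , T⊆S , sums = cong not (begin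
        rowComb G c e                    ≡⟨ xsum-cong (λ i → cong (c i ∧_) (sym (sums i))) ⟩
        dot c (colSum G T)               ≡⟨ sym (dot-colSum G T c) ⟩
        xsum (λ e' → T e' ∧ rowComb G c e') ≡⟨ xsum-cong (zero-on-T T T⊆S) ⟩
        xsum {n} (λ _ → false)           ≡⟨ xsum-zero {n} ⟩
        false ∎)
      where open ≡-Reasoning

basis-vanishCount : ∀ {m n} (G : Matrix m n) (B : Bits n) → 2 ^ suppSize (basis G B) * vanishCount G B ≡ 2 ^ m
basis-vanishCount {m} G B = begin
    2 ^ suppSize (basis G B) * vanishCount G B
      ≡⟨ cong (2 ^ suppSize (basis G B) *_)
              (sumℕ-cong (λ c → cong (λ b → if b then 1 else 0) (vanishesOn-basis G B c)) (allFuns m)) ⟩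
    2 ^ suppSize (basis G B) * vanishCount G (basis G B)
      ≡⟨ vanishCount-independent G (basis G B) (proj₁ (basis-spec G B)) ⟩
    2 ^ m ∎
  where
  open ≡-Reasoning
  sumℕ-cong : ∀ {A : Set} {f g : A → ℕ} → (∀ x → f x ≡ g x) → ∀ l → sumℕ f l ≡ sumℕ g l
  sumℕ-cong h [] = refl
  sumℕ-cong h (x ∷ l) = cong₂ _+_ (h x) (sumℕ-cong h l)

exponent-antitone : ∀ a b X Y m → 2 ^ a * X ≡ 2 ^ m → 2 ^ b * Y ≡ 2 ^ m → Y ≤ X → a ≤ b
exponent-antitone a b X Y m eqX eqY Y≤X =
  ℕP.≮⇒≥ (λ b<a → ℕP.<⇒≱ (ℕP.^-monoʳ-< 2 (s≤s (s≤s z≤n)) b<a) (ℕP.*-cancelʳ-≤ (2 ^ a) (2 ^ b) Y {{Y≢0}} le))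
  where
  Y≢0 = ≢-nonZero (λ Y≡0 → ℕP.<⇒≢ (ℕP.m^n>0 2 m)
                     (sym (trans (sym eqY) (trans (cong (2 ^ b *_) Y≡0) (ℕP.*-zeroʳ (2 ^ b))))))
  le : 2 ^ a * Y ≤ 2 ^ b * Y
  le = ℕP.≤-trans (ℕP.*-monoʳ-≤ (2 ^ a) Y≤X) (ℕP.≤-reflexive (trans eqX (sym eqY)))

maxℕ-lub : ∀ {A : Set} (f : A → ℕ) {b} → (∀ x → f x ≤ b) → ∀ l → maxℕ f l ≤ b
maxℕ-lub f bound [] = z≤n
maxℕ-lub f bound (x ∷ l) = ℕP.⊔-lub (bound x) (maxℕ-lub f bound l)

maxℕ-ub : ∀ {A : Set} (f : A → ℕ) {x l} → x ∈ l → f x ≤ maxℕ f l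
maxℕ-ub f {l = x ∷ l} (here refl) = ℕP.m≤m⊔n (f x) _
maxℕ-ub f {l = y ∷ l} (there m) = ℕP.m≤n⇒m≤o⊔n (f y) (maxℕ-ub f m)

independent-cong : ∀ {m n} (G : Matrix m n) {S S' : Bits n} → S ≗ S' → independent G S ≡ independent G S'
independent-cong {n = n} G {S} {S'} eq = allL-cong (allFuns n)
  where
  allL-cong : ∀ l → allL (independencePred G S) l ≡ allL (independencePred G S') l
  allL-cong [] = refl
  allL-cong (T ∷ l) = cong₂ _∧_ (cong (λ b → not (b ∧ anyB T) ∨ anyB (colSum G T))
                                     (allB-cong (λ x → cong (not (T x) ∨_) (eq x)))) (allL-cong l)

-- The rank of B (a maximum over independent subsets of B) is the size of its greedy basis:
-- every independent S ⊆ B has 2^{|S|} W_B ≤ 2^{|S|} W_S = 2^m = 2^{|basis|} W_B, and the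
-- basis itself is one of the candidates.
rk-basis : ∀ {m n} (G : Matrix m n) (B : Bits n) → rk G B ≡ suppSize (basis G B)
rk-basis {m} {n} G B = ℕP.≤-antisym (maxℕ-lub candidate bounded (allFuns n))
                                    (ℕP.≤-trans (ℕP.≤-reflexive (sym attained)) (maxℕ-ub candidate f∈))
  where
  S₀ = basis G B
  candidate : Bits n → ℕ
  candidate S = if subsetB S B ∧ independent G S then suppSize S else 0
  bounded : ∀ S → candidate S ≤ suppSize S₀
  bounded S with subsetB S B in S⊆B | independent G S in ind
  ... | false | _ = z≤n
  ... | true | false = z≤n
  ... | true | true = exponent-antitone (suppSize S) (suppSize S₀) (vanishCount G S) (vanishCount G B) m
                        (vanishCount-independent G S ind) (basis-vanishCount G B)
                        (vanishCount-antitone G (subset-elim S B S⊆B))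
  f = proj₁ (∈-allFuns S₀)
  f∈ = proj₁ (proj₂ (∈-allFuns S₀))
  f≗S₀ = proj₂ (proj₂ (∈-allFuns S₀))
  attained : candidate f ≡ suppSize S₀
  attained rewrite subset-cong {S = B} f≗S₀ | independent-cong G f≗S₀
                 | subset-intro {T = S₀} {S = B} (proj₁ (proj₂ (basis-spec G B))) | proj₁ (basis-spec G B)
                 = suppSize-cong f≗S₀

rk-vanishCount : ∀ {m n} (G : Matrix m n) (B : Bits n) → 2 ^ rk G B * vanishCount G B ≡ 2 ^ m
rk-vanishCount G B = trans (cong (λ k → 2 ^ k * vanishCount G B) (rk-basis G B)) (basis-vanishCount G B)

-- Counting pairs of row-space vectors without a common zero.

cover : ∀ {n} → Bits n → Bits n → Bool
cover u v = allB (λ e → u e ∨ v e)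

cover-as-product : ∀ {n} (u v : Bits n) → [ cover u v ]ℤ ≡ ∏ℤ (λ e → + 1 ℤ.+ -[1+ 0 ] ℤ.* [ not (u e) ∧ not (v e) ]ℤ)
cover-as-product {zero} u v = refl
cover-as-product {suc n} u v with u zero | v zero
... | true | _ = trans (cover-as-product (u ∘ suc) (v ∘ suc)) (sym (ℤP.*-identityˡ _))
... | false | true = trans (cover-as-product (u ∘ suc) (v ∘ suc)) (sym (ℤP.*-identityˡ _))
... | false | false = sym (ℤP.*-zeroˡ (∏ℤ (λ e → + 1 ℤ.+ -[1+ 0 ] ℤ.* [ not (u (suc e)) ∧ not (v (suc e)) ]ℤ)))

signOf : ∀ {n} → Bits n → ℤ
signOf B = (ℤ.- (+ 1)) ℤ.^ suppSize B

prod-common-zeros : ∀ {n} (B u v : Bits n) →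
  ∏ℤ (λ e → if B e then -[1+ 0 ] ℤ.* [ not (u e) ∧ not (v e) ]ℤ else + 1)
  ≡ signOf B ℤ.* ([ allB (λ e → not (B e) ∨ not (u e)) ]ℤ ℤ.* [ allB (λ e → not (B e) ∨ not (v e)) ]ℤ)
prod-common-zeros {zero} B u v = refl
prod-common-zeros {suc n} B u v with B zero | u zero | v zero
... | false | _ | _ = trans (ℤP.*-identityˡ _) (prod-common-zeros (B ∘ suc) (u ∘ suc) (v ∘ suc))
... | true | false | false = trans (cong (-[1+ 0 ] ℤ.* + 1 ℤ.*_) (prod-common-zeros (B ∘ suc) (u ∘ suc) (v ∘ suc)))
                                   (regroup (signOf (B ∘ suc)) [ vanish (u ∘ suc) ]ℤ [ vanish (v ∘ suc) ]ℤ)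
  where
  vanish : Bits n → Bool
  vanish w = allB (λ e → not (B (suc e)) ∨ not (w e))
  regroup : ∀ s a b → ((ℤ.- + 1) ℤ.* + 1) ℤ.* (s ℤ.* (a ℤ.* b)) ≡ ((ℤ.- + 1) ℤ.* s) ℤ.* (a ℤ.* b)
  regroup = solve-∀
... | true | true | _ = trans (ℤP.*-zeroˡ later) (sym (ℤP.*-zeroʳ (-[1+ 0 ] ℤ.* signOf (B ∘ suc))))
  where
  later = ∏ℤ (λ e → if B (suc e) then -[1+ 0 ] ℤ.* [ not (u (suc e)) ∧ not (v (suc e)) ]ℤ else + 1)
... | true | false | true = trans (ℤP.*-zeroˡ later)
    (sym (trans (cong (-[1+ 0 ] ℤ.* signOf (B ∘ suc) ℤ.*_) (ℤP.*-zeroʳ [ allB (λ e → not (B (suc e)) ∨ not (u (suc e))) ]ℤ))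
                (ℤP.*-zeroʳ (-[1+ 0 ] ℤ.* signOf (B ∘ suc)))))
  where
  later = ∏ℤ (λ e → if B (suc e) then -[1+ 0 ] ℤ.* [ not (u (suc e)) ∧ not (v (suc e)) ]ℤ else + 1)

cover-expansion : ∀ {n} (u v : Bits n) →
  [ cover u v ]ℤ ≡ ∑ℤ (λ B → signOf B ℤ.* ([ allB (λ e → not (B e) ∨ not (u e)) ]ℤ
                                         ℤ.* [ allB (λ e → not (B e) ∨ not (v e)) ]ℤ)) (allFuns n)
cover-expansion {n} u v = trans (cover-as-product u v)
  (trans (ℤΣ.prod-expand (λ _ → + 1) (λ e → -[1+ 0 ] ℤ.* [ not (u e) ∧ not (v e) ]ℤ))
         (ℤΣ.sum-cong (λ B → prod-common-zeros B u v) (allFuns n)))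

coverCount : ∀ {m n} → Matrix m n → ℤ
coverCount {m} G = ∑ℤ (λ c₁ → ∑ℤ (λ c₂ → [ cover (rowComb G c₁) (rowComb G c₂) ]ℤ) (allFuns m)) (allFuns m)

coverCount-inclusion-exclusion : ∀ {m n} (G : Matrix m n) →
  coverCount G ≡ ∑ℤ (λ B → signOf B ℤ.* (+ vanishCount G B ℤ.* + vanishCount G B)) (allFuns n)
coverCount-inclusion-exclusion {m} {n} G = begin
    coverCount G
      ≡⟨ ℤΣ.sum-cong (λ c₁ → ℤΣ.sum-cong (λ c₂ → cover-expansion (rowComb G c₁) (rowComb G c₂)) M) M ⟩
    ∑ℤ (λ c₁ → ∑ℤ (λ c₂ → ∑ℤ (λ B → φ B c₁ c₂) L) M) M
      ≡⟨ ℤΣ.sum-cong (λ c₁ → ℤΣ.sum-swap (λ c₂ B → φ B c₁ c₂) M L) M ⟩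
    ∑ℤ (λ c₁ → ∑ℤ (λ B → ∑ℤ (λ c₂ → φ B c₁ c₂) M) L) M
      ≡⟨ ℤΣ.sum-swap (λ c₁ B → ∑ℤ (λ c₂ → φ B c₁ c₂) M) M L ⟩
    ∑ℤ (λ B → ∑ℤ (λ c₁ → ∑ℤ (λ c₂ → φ B c₁ c₂) M) M) L
      ≡⟨ ℤΣ.sum-cong factorise L ⟩
    ∑ℤ (λ B → signOf B ℤ.* (+ vanishCount G B ℤ.* + vanishCount G B)) L ∎
  where
  open ≡-Reasoning
  M = allFuns m
  L = allFuns n
  a : Bits n → Bits m → ℤ
  a B c = [ vanishesOn G B c ]ℤ
  φ : Bits n → Bits m → Bits m → ℤ
  φ B c₁ c₂ = signOf B ℤ.* (a B c₁ ℤ.* a B c₂)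
  W : Bits n → ℤ
  W B = ∑ℤ (a B) M
  factorise : ∀ B → ∑ℤ (λ c₁ → ∑ℤ (λ c₂ → φ B c₁ c₂) M) M ≡ signOf B ℤ.* (+ vanishCount G B ℤ.* + vanishCount G B)
  factorise B = begin
      ∑ℤ (λ c₁ → ∑ℤ (λ c₂ → φ B c₁ c₂) M) M
        ≡⟨ ℤΣ.sum-cong (λ c₁ → trans (ℤΣ.sum-cong (λ c₂ → sym (ℤP.*-assoc (signOf B) (a B c₁) (a B c₂))) M)
                                      (ℤΣ.sum-*ˡ (signOf B ℤ.* a B c₁) (a B) M)) M ⟩
      ∑ℤ (λ c₁ → (signOf B ℤ.* a B c₁) ℤ.* W B) M
        ≡⟨ ℤΣ.sum-*ʳ (W B) (λ c₁ → signOf B ℤ.* a B c₁) M ⟩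
      ∑ℤ (λ c₁ → signOf B ℤ.* a B c₁) M ℤ.* W B
        ≡⟨ cong (ℤ._* W B) (ℤΣ.sum-*ˡ (signOf B) (a B) M) ⟩
      (signOf B ℤ.* W B) ℤ.* W B
        ≡⟨ ℤP.*-assoc (signOf B) (W B) (W B) ⟩
      signOf B ℤ.* (W B ℤ.* W B)
        ≡⟨ cong (λ w → signOf B ℤ.* (w ℤ.* w)) (sym (count-ℤ (vanishesOn G B) M)) ⟩
      signOf B ℤ.* (+ vanishCount G B ℤ.* + vanishCount G B) ∎

power-cofactor : ∀ a W m → 2 ^ a * W ≡ 2 ^ m → (a ≤ m) × (W ≡ 2 ^ (m ∸ a))
power-cofactor a W m eq = a≤m , ℕP.*-cancelˡ-≡ W (2 ^ (m ∸ a)) (2 ^ a) {{ℕP.m^n≢0 2 a}}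
    (trans eq (trans (cong (2 ^_) (sym (ℕP.m+[n∸m]≡n a≤m))) (ℕP.^-distribˡ-+-* 2 a (m ∸ a))))
  where
  a≤m : a ≤ m
  a≤m = exponent-antitone a m W 1 m eq (ℕP.*-identityʳ (2 ^ m))
          (ℕP.n≢0⇒n>0 (λ W≡0 → ℕP.<⇒≢ (ℕP.m^n>0 2 m)
             (sym (trans (sym eq) (trans (cong (2 ^ a *_) W≡0) (ℕP.*-zeroʳ (2 ^ a)))))))

rk≤rank : ∀ {m n} (G : Matrix m n) (B : Bits n) → rk G B ≤ rank G
rk≤rank {m} G B = exponent-antitone (rk G B) (rank G) (vanishCount G B) (vanishCount G (λ _ → true)) m
                    (rk-vanishCount G B) (rk-vanishCount G (λ _ → true)) (vanishCount-antitone G (λ _ _ → refl))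

square-of-power-of-two : ∀ k → 2 ^ k * 2 ^ k ≡ 4 ^ k
square-of-power-of-two zero = refl
square-of-power-of-two (suc k) = trans (regroup (2 ^ k)) (cong (4 *_) (square-of-power-of-two k))
  where
  regroup : ∀ a → (2 * a) * (2 * a) ≡ 4 * (a * a)
  regroup = ℕSolver.solve-∀

pos-^ : ∀ a k → + (a ^ k) ≡ (+ a) ℤ.^ k
pos-^ a zero = refl
pos-^ a (suc k) = trans (ℤP.pos-* a (a ^ k)) (cong (+ a ℤ.*_) (pos-^ a k))

-- (-1)^{|B|} W_B² = 4^{m-r} (-1)^{|B|} 4^{r - rk B}, using W_B = 2^{m - rk B} and rk B ≤ r ≤ m.
signed-square : ∀ {m n} (G : Matrix m n) (B : Bits n) →
  signOf B ℤ.* (+ vanishCount G B ℤ.* + vanishCount G B) ≡ + (4 ^ (m ∸ rank G)) ℤ.* (signOf B ℤ.* (+ 4) ℤ.^ (rank G ∸ rk G B))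
signed-square {m} G B = begin
    signOf B ℤ.* (+ vanishCount G B ℤ.* + vanishCount G B)
      ≡⟨ cong (λ w → signOf B ℤ.* (+ w ℤ.* + w)) W≡ ⟩
    signOf B ℤ.* (+ (2 ^ (m ∸ k)) ℤ.* + (2 ^ (m ∸ k)))
      ≡⟨ cong (signOf B ℤ.*_) (trans (sym (ℤP.pos-* (2 ^ (m ∸ k)) (2 ^ (m ∸ k)))) (cong +_ (square-of-power-of-two (m ∸ k)))) ⟩
    signOf B ℤ.* + (4 ^ (m ∸ k))
      ≡⟨ cong (λ j → signOf B ℤ.* + (4 ^ j)) split ⟩
    signOf B ℤ.* + (4 ^ ((m ∸ r) + (r ∸ k)))
      ≡⟨ cong (λ j → signOf B ℤ.* + j) (ℕP.^-distribˡ-+-* 4 (m ∸ r) (r ∸ k)) ⟩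
    signOf B ℤ.* + (4 ^ (m ∸ r) * 4 ^ (r ∸ k))
      ≡⟨ cong (signOf B ℤ.*_) (trans (ℤP.pos-* (4 ^ (m ∸ r)) (4 ^ (r ∸ k))) (cong (+ (4 ^ (m ∸ r)) ℤ.*_) (pos-^ 4 (r ∸ k)))) ⟩
    signOf B ℤ.* (+ (4 ^ (m ∸ r)) ℤ.* (+ 4) ℤ.^ (r ∸ k))
      ≡⟨ ℤΣ.*-swapˡ (signOf B) (+ (4 ^ (m ∸ r))) ((+ 4) ℤ.^ (r ∸ k)) ⟩
    + (4 ^ (m ∸ r)) ℤ.* (signOf B ℤ.* (+ 4) ℤ.^ (r ∸ k)) ∎
  where
  open ≡-Reasoning
  k = rk G B
  r = rank G
  W≡ : vanishCount G B ≡ 2 ^ (m ∸ k)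
  W≡ = proj₂ (power-cofactor k (vanishCount G B) m (rk-vanishCount G B))
  r≤m : r ≤ m
  r≤m = proj₁ (power-cofactor r (vanishCount G (λ _ → true)) m (rk-vanishCount G (λ _ → true)))
  split : m ∸ k ≡ (m ∸ r) + (r ∸ k)
  split = trans (cong (_∸ k) (sym (ℕP.m∸n+n≡m r≤m))) (ℕP.+-∸-assoc (m ∸ r) (rk≤rank G B))

coverCount-χ : ∀ {m n} (G : Matrix m n) → coverCount G ≡ + (4 ^ (m ∸ rank G)) ℤ.* χ G (+ 4)
coverCount-χ {m} {n} G = trans (coverCount-inclusion-exclusion G) (trans (ℤΣ.sum-cong (signed-square G) (allFuns n))
  (ℤΣ.sum-*ˡ (+ (4 ^ (m ∸ rank G))) (λ B → signOf B ℤ.* (+ 4) ℤ.^ (rank G ∸ rk G B)) (allFuns n)))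

-- The Eisenstein integers ℤ[ω] = {x + yω}, where ω = e^{iπ/3} is a primitive sixth root of
-- unity: ω² = ω - 1 and ω⁶ = 1.
𝔼 : Set
𝔼 = ℤ × ℤ

infixl 6 _+E_
infixl 7 _*E_

_+E_ : 𝔼 → 𝔼 → 𝔼
(a , b) +E (c , d) = (a ℤ.+ c , b ℤ.+ d)

_*E_ : 𝔼 → 𝔼 → 𝔼
(a , b) *E (c , d) = (a ℤ.* c ℤ.- b ℤ.* d , a ℤ.* d ℤ.+ b ℤ.* c ℤ.+ b ℤ.* d)

𝔼-semiring : CommSemiring≡
𝔼-semiring = record
  { Carrier = 𝔼 ; _⊕_ = _+E_ ; _⊛_ = _*E_ ; 0# = (+ 0 , + 0) ; 1# = (+ 1 , + 0)
  ; +-assoc = λ { (a , b) (c , d) (e , f) → cong₂ _,_ (ℤP.+-assoc a c e) (ℤP.+-assoc b d f) }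
  ; +-comm = λ { (a , b) (c , d) → cong₂ _,_ (ℤP.+-comm a c) (ℤP.+-comm b d) }
  ; +-identityˡ = λ { (a , b) → cong₂ _,_ (ℤP.+-identityˡ a) (ℤP.+-identityˡ b) }
  ; *-assoc = λ { (a , b) (c , d) (e , f) → cong₂ _,_ (*-assoc₁ a b c d e f) (*-assoc₂ a b c d e f) }
  ; *-comm = λ { (a , b) (c , d) → cong₂ _,_ (*-comm₁ a b c d) (*-comm₂ a b c d) }
  ; *-identityˡ = λ { (a , b) → cong₂ _,_ (*-identityˡ₁ a b) (*-identityˡ₂ a b) }
  ; distribʳ = λ { (a , b) (c , d) (e , f) → cong₂ _,_ (distribʳ₁ a b c d e f) (distribʳ₂ a b c d e f) }
  ; zeroˡ = λ { (a , b) → cong₂ _,_ (zeroˡ₁ a b) (zeroˡ₂ a b) } }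
  where
  *-assoc₁ : ∀ a b c d e f → (a ℤ.* c ℤ.- b ℤ.* d) ℤ.* e ℤ.- (a ℤ.* d ℤ.+ b ℤ.* c ℤ.+ b ℤ.* d) ℤ.* f
                            ≡ a ℤ.* (c ℤ.* e ℤ.- d ℤ.* f) ℤ.- b ℤ.* (c ℤ.* f ℤ.+ d ℤ.* e ℤ.+ d ℤ.* f)
  *-assoc₁ = solve-∀
  *-assoc₂ : ∀ a b c d e f → (a ℤ.* c ℤ.- b ℤ.* d) ℤ.* f ℤ.+ (a ℤ.* d ℤ.+ b ℤ.* c ℤ.+ b ℤ.* d) ℤ.* e
                               ℤ.+ (a ℤ.* d ℤ.+ b ℤ.* c ℤ.+ b ℤ.* d) ℤ.* f
                            ≡ a ℤ.* (c ℤ.* f ℤ.+ d ℤ.* e ℤ.+ d ℤ.* f) ℤ.+ b ℤ.* (c ℤ.* e ℤ.- d ℤ.* f)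
                               ℤ.+ b ℤ.* (c ℤ.* f ℤ.+ d ℤ.* e ℤ.+ d ℤ.* f)
  *-assoc₂ = solve-∀
  *-comm₁ : ∀ a b c d → a ℤ.* c ℤ.- b ℤ.* d ≡ c ℤ.* a ℤ.- d ℤ.* b
  *-comm₁ = solve-∀
  *-comm₂ : ∀ a b c d → a ℤ.* d ℤ.+ b ℤ.* c ℤ.+ b ℤ.* d ≡ c ℤ.* b ℤ.+ d ℤ.* a ℤ.+ d ℤ.* b
  *-comm₂ = solve-∀
  *-identityˡ₁ : ∀ a b → + 1 ℤ.* a ℤ.- + 0 ℤ.* b ≡ a
  *-identityˡ₁ = solve-∀
  *-identityˡ₂ : ∀ a b → + 1 ℤ.* b ℤ.+ + 0 ℤ.* a ℤ.+ + 0 ℤ.* b ≡ b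
  *-identityˡ₂ = solve-∀
  distribʳ₁ : ∀ a b c d e f → (c ℤ.+ e) ℤ.* a ℤ.- (d ℤ.+ f) ℤ.* b ≡ (c ℤ.* a ℤ.- d ℤ.* b) ℤ.+ (e ℤ.* a ℤ.- f ℤ.* b)
  distribʳ₁ = solve-∀
  distribʳ₂ : ∀ a b c d e f → (c ℤ.+ e) ℤ.* b ℤ.+ (d ℤ.+ f) ℤ.* a ℤ.+ (d ℤ.+ f) ℤ.* b
                             ≡ (c ℤ.* b ℤ.+ d ℤ.* a ℤ.+ d ℤ.* b) ℤ.+ (e ℤ.* b ℤ.+ f ℤ.* a ℤ.+ f ℤ.* b)
  distribʳ₂ = solve-∀
  zeroˡ₁ : ∀ a b → + 0 ℤ.* a ℤ.- + 0 ℤ.* b ≡ + 0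
  zeroˡ₁ = solve-∀
  zeroˡ₂ : ∀ a b → + 0 ℤ.* b ℤ.+ + 0 ℤ.* a ℤ.+ + 0 ℤ.* b ≡ + 0
  zeroˡ₂ = solve-∀

module 𝔼Σ = FiniteSums 𝔼-semiring
open 𝔼Σ using (_^ⁿ_) renaming (∑ to ∑E; ∏ to ∏E; [_] to [_]E)

ω : 𝔼
ω = (+ 0 , + 1)

-- ρ = ω + ω² = -1 + 2ω = √-3.
ρ : 𝔼
ρ = (-[1+ 0 ] , + 2)

ω^-mod6 : ∀ w → ω ^ⁿ w ≡ ω ^ⁿ (w % 6)
ω^-mod6 w = begin
    ω ^ⁿ w                                   ≡⟨ cong (ω ^ⁿ_) (m≡m%n+[m/n]*n w 6) ⟩
    ω ^ⁿ (w % 6 + (w / 6) * 6)               ≡⟨ 𝔼Σ.^ⁿ-+ ω (w % 6) ((w / 6) * 6) ⟩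
    ω ^ⁿ (w % 6) *E ω ^ⁿ ((w / 6) * 6)       ≡⟨ cong (ω ^ⁿ (w % 6) *E_) (𝔼Σ.^ⁿ-* ω (w / 6) 6) ⟩
    ω ^ⁿ (w % 6) *E (ω ^ⁿ 6) ^ⁿ (w / 6)      ≡⟨ cong (ω ^ⁿ (w % 6) *E_) (𝔼Σ.1^ⁿ (w / 6)) ⟩
    ω ^ⁿ (w % 6) *E (+ 1 , + 0)              ≡⟨ 𝔼Σ.*-identityʳ (ω ^ⁿ (w % 6)) ⟩
    ω ^ⁿ (w % 6) ∎
  where open ≡-Reasoning

bit : Bool → ℕ
bit b = if b then 1 else 0

-- One coordinate's share of |f| + |f + u| + |f + u + v|, with f_e = x, u_e = a, v_e = b.
localWeight : Bool → Bool → Bool → ℕ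
localWeight x a b = bit x + bit (x xor a) + bit ((x xor a) xor b)

-- Σ_x ω^{localWeight x a b} is 1 + ω³ = 0 when a = b = 0, and ω + ω² = ρ otherwise.
local-factor : ∀ a b → ω ^ⁿ localWeight false a b +E ω ^ⁿ localWeight true a b ≡ [ a ∨ b ]E *E ρ
local-factor false false = refl
local-factor false true = refl
local-factor true false = refl
local-factor true true = refl

tripleWeight : ∀ {n} → Bits n → Bits n → Bits n → ℕ
tripleWeight f u v = suppSize f + suppSize (λ e → f e xor u e) + suppSize (λ e → (f e xor u e) xor v e)

weight-sum-factorises : ∀ {n} (u v : Bits n) →
  ∑E (λ f → ω ^ⁿ tripleWeight f u v) (allFuns n) ≡ ∏E (λ e → [ u e ∨ v e ]E *E ρ)
weight-sum-factorises {zero} u v = refl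
weight-sum-factorises {suc n} u v = begin
    ∑E (λ f → ω ^ⁿ tripleWeight f u v) (allFuns (suc n))
      ≡⟨ 𝔼Σ.sum-split (λ f → ω ^ⁿ tripleWeight f u v) ⟩
    ∑E (λ g → ω ^ⁿ tripleWeight (cons false g) u v +E ω ^ⁿ tripleWeight (cons true g) u v) (allFuns n)
      ≡⟨ 𝔼Σ.sum-cong (λ g → cong₂ _+E_ (split-off false g) (split-off true g)) (allFuns n) ⟩
    ∑E (λ g → local false *E rest g +E local true *E rest g) (allFuns n)
      ≡⟨ 𝔼Σ.sum-cong (λ g → sym (𝔼Σ.distribʳ (rest g) (local false) (local true))) (allFuns n) ⟩
    ∑E (λ g → (local false +E local true) *E rest g) (allFuns n)
      ≡⟨ 𝔼Σ.sum-*ˡ (local false +E local true) rest (allFuns n) ⟩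
    (local false +E local true) *E ∑E rest (allFuns n)
      ≡⟨ cong₂ _*E_ (local-factor (u zero) (v zero)) (weight-sum-factorises (u ∘ suc) (v ∘ suc)) ⟩
    ∏E (λ e → [ u e ∨ v e ]E *E ρ) ∎
  where
  open ≡-Reasoning
  local : Bool → 𝔼
  local x = ω ^ⁿ localWeight x (u zero) (v zero)
  rest : Bits n → 𝔼
  rest g = ω ^ⁿ tripleWeight g (u ∘ suc) (v ∘ suc)
  regroup : ∀ a b c x y z → (a + x) + (b + y) + (c + z) ≡ (a + b + c) + (x + y + z)
  regroup = ℕSolver.solve-∀
  split-off : ∀ x g → ω ^ⁿ tripleWeight (cons x g) u v ≡ local x *E rest g
  split-off x g = trans (cong (ω ^ⁿ_) (regroup (bit x) (bit (x xor u zero)) (bit ((x xor u zero) xor v zero)) _ _ _))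
                        (𝔼Σ.^ⁿ-+ ω (localWeight x (u zero) (v zero)) (tripleWeight g (u ∘ suc) (v ∘ suc)))

weight-sum : ∀ {n} (u v : Bits n) → ∑E (λ f → ω ^ⁿ tripleWeight f u v) (allFuns n) ≡ [ cover u v ]E *E ρ ^ⁿ n
weight-sum u v = trans (weight-sum-factorises u v) (𝔼Σ.prod-indicator (λ e → u e ∨ v e) ρ)

module RowSpaceSums (R : CommSemiring≡) {m n : ℕ} (G : Matrix m n) where
  open FiniteSums R

  _≟ᵇ_ : Bits n → Bits n → Bool
  f ≟ᵇ g = allB (λ e → not (f e xor g e))

  -- K = #{c : cG = 0}: every row-space vector is cG for exactly K vectors c.
  K : Carrier
  K = ∑ (λ c → [ isZero (rowComb G c) ]) (allFuns m)

  fibre-size : ∀ x → K ⊛ [ inRowSpace G x ] ≡ ∑ (λ c → [ x ≟ᵇ rowComb G c ]) (allFuns m)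
  fibre-size x with inRowSpace G x in x∈
  ... | false = trans (zeroʳ K) (sym (trans (sum-cong (λ c → cong [_] (no-preimage c)) (allFuns m)) (sum-zero (allFuns m))))
    where
    no-preimage : ∀ c → x ≟ᵇ rowComb G c ≡ false
    no-preimage c with x ≟ᵇ rowComb G c in hit
    ... | false = refl
    ... | true = ⊥-elim (t≢f (trans (sym (anyAll-intro resp c hit)) x∈))
      where
      resp : Resp (λ c → x ≟ᵇ rowComb G c)
      resp eq = allB-cong (λ e → cong (λ t → not (x e xor t)) (rowComb-cong G eq e))
  ... | true with anyL-elim {p = λ c → x ≟ᵇ rowComb G c} (allFuns m) x∈
  ...   | c₀ , _ , x≡c₀G = trans (*-identityʳ K) (sym (trans (sum-cong shift (allFuns m))
             (sum-translate (λ c → [ isZero (rowComb G c) ]) (λ eq → cong [_] (allB-cong (λ e → cong not (rowComb-cong G eq e)))) c₀)))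
    where
    shift : ∀ c → [ x ≟ᵇ rowComb G c ] ≡ [ isZero (rowComb G (λ i → c i xor c₀ i)) ]
    shift c = cong [_] (allB-cong (λ e → cong not (begin
        x e xor rowComb G c e                  ≡⟨ cong (_xor rowComb G c e) (not-xor⇒≡ (x e) (rowComb G c₀ e) (allB-elim x≡c₀G e)) ⟩
        rowComb G c₀ e xor rowComb G c e       ≡⟨ xor-comm (rowComb G c₀ e) (rowComb G c e) ⟩
        rowComb G c e xor rowComb G c₀ e       ≡⟨ sym (rowComb-xor G c c₀ e) ⟩
        rowComb G (λ i → c i xor c₀ i) e ∎)))
      where open ≡-Reasoning

  coset-sum : ∀ (y : Bits n) (F : Bits n → Carrier) → Resp F →
    K ⊛ ∑ (λ f → [ inRowSpace G (λ e → y e xor f e) ] ⊛ F f) (allFuns n)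
    ≡ ∑ (λ c → F (λ e → y e xor rowComb G c e)) (allFuns m)
  coset-sum y F rF = begin
      K ⊛ ∑ (λ f → [ inRowSpace G (y ⊞ f) ] ⊛ F f) (allFuns n)
        ≡⟨ sym (sum-*ˡ K _ (allFuns n)) ⟩
      ∑ (λ f → K ⊛ ([ inRowSpace G (y ⊞ f) ] ⊛ F f)) (allFuns n)
        ≡⟨ sum-cong (λ f → trans (sym (*-assoc _ _ _)) (cong (_⊛ F f) (fibre-size (y ⊞ f)))) (allFuns n) ⟩
      ∑ (λ f → ∑ (λ c → [ (y ⊞ f) ≟ᵇ rowComb G c ]) (allFuns m) ⊛ F f) (allFuns n)
        ≡⟨ sum-cong (λ f → sym (sum-*ʳ (F f) (λ c → [ (y ⊞ f) ≟ᵇ rowComb G c ]) (allFuns m))) (allFuns n) ⟩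
      ∑ (λ f → ∑ (λ c → [ (y ⊞ f) ≟ᵇ rowComb G c ] ⊛ F f) (allFuns m)) (allFuns n)
        ≡⟨ sum-swap (λ f c → [ (y ⊞ f) ≟ᵇ rowComb G c ] ⊛ F f) (allFuns n) (allFuns m) ⟩
      ∑ (λ c → ∑ (λ f → [ (y ⊞ f) ≟ᵇ rowComb G c ] ⊛ F f) (allFuns n)) (allFuns m)
        ≡⟨ sum-cong (λ c → trans (sum-cong (λ f → cong (λ b → [ b ] ⊛ F f) (move-y f (rowComb G c))) (allFuns n))
                                  (sum-delta F rF (y ⊞ rowComb G c))) (allFuns m) ⟩
      ∑ (λ c → F (y ⊞ rowComb G c)) (allFuns m) ∎
    where
    open ≡-Reasoning
    _⊞_ : Bits n → Bits n → Bits n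
    (f ⊞ g) e = f e xor g e
    move-y : ∀ f r → (y ⊞ f) ≟ᵇ r ≡ f ≟ᵇ (y ⊞ r)
    move-y f r = allB-cong (λ e → cong not (trans (GF2.+-assoc (y e) (f e) (r e)) (xor-swapˡ (y e) (f e) (r e))))

ω^-by-residue : ∀ w → ω ^ⁿ w ≡ ∑E (λ k → [ (w % 6) ≡ᵇ k ]E *E ω ^ⁿ k) (upTo 6)
ω^-by-residue w = trans (ω^-mod6 w) (by-residue (w % 6) (m%n<n w 6))
  where
  by-residue : ∀ r → r < 6 → ω ^ⁿ r ≡ ∑E (λ k → [ r ≡ᵇ k ]E *E ω ^ⁿ k) (upTo 6)
  by-residue 0 _ = refl
  by-residue 1 _ = refl
  by-residue 2 _ = refl
  by-residue 3 _ = refl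
  by-residue 4 _ = refl
  by-residue 5 _ = refl
  by-residue (suc (suc (suc (suc (suc (suc r)))))) (s≤s (s≤s (s≤s (s≤s (s≤s (s≤s ()))))))

⟨_⟩ : ℤ → 𝔼
⟨ z ⟩ = (z , + 0)

⟨⟩-[] : ∀ b → [ b ]E ≡ ⟨ [ b ]ℤ ⟩
⟨⟩-[] true = refl
⟨⟩-[] false = refl

⟨⟩-sum : ∀ {A : Set} (f : A → ℤ) l → ∑E (λ x → ⟨ f x ⟩) l ≡ ⟨ ∑ℤ f l ⟩
⟨⟩-sum f [] = refl
⟨⟩-sum f (x ∷ l) = cong (⟨ f x ⟩ +E_) (⟨⟩-sum f l)

⟨⟩-sumℕ : ∀ {A : Set} (f : A → ℕ) l → ⟨ + sumℕ f l ⟩ ≡ ∑E (λ x → ⟨ + f x ⟩) l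
⟨⟩-sumℕ f l = trans (cong ⟨_⟩ (sumℕ-ℤ f l)) (sym (⟨⟩-sum (λ x → + f x) l))

⟨⟩-indicator : ∀ b → ⟨ + (if b then 1 else 0) ⟩ ≡ [ b ]E
⟨⟩-indicator true = refl
⟨⟩-indicator false = refl

scale : ∀ k a b → ⟨ k ⟩ *E (a , b) ≡ (k ℤ.* a , k ℤ.* b)
scale k a b = cong₂ _,_ (first k a b) (second k a b)
  where
  first : ∀ k a b → k ℤ.* a ℤ.- + 0 ℤ.* b ≡ k ℤ.* a
  first = solve-∀
  second : ∀ k a b → k ℤ.* b ℤ.+ + 0 ℤ.* a ℤ.+ + 0 ℤ.* b ≡ k ℤ.* b
  second = solve-∀

⟨⟩-* : ∀ a b → ⟨ a ⟩ *E ⟨ b ⟩ ≡ ⟨ a ℤ.* b ⟩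
⟨⟩-* a b = trans (scale a b (+ 0)) (cong (a ℤ.* b ,_) (ℤP.*-zeroʳ a))

⟨⟩-^ⁿ : ∀ z h → ⟨ z ⟩ ^ⁿ h ≡ ⟨ z ℤ.^ h ⟩
⟨⟩-^ⁿ z zero = refl
⟨⟩-^ⁿ z (suc h) = trans (cong (⟨ z ⟩ *E_) (⟨⟩-^ⁿ z h)) (⟨⟩-* z (z ℤ.^ h))

⟨⟩-cancel : ∀ k .{{_ : ℤ.NonZero k}} x y → ⟨ k ⟩ *E x ≡ ⟨ k ⟩ *E y → x ≡ y
⟨⟩-cancel k (a , b) (c , d) eq with trans (sym (scale k a b)) (trans eq (scale k c d))
... | eq' = cong₂ _,_ (ℤP.*-cancelˡ-≡ k a c (cong proj₁ eq')) (ℤP.*-cancelˡ-≡ k b d (cong proj₂ eq'))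

-- The coordinates of Σ_{k < 6} t_k ω^k, using ω^0, …, ω^5 = 1, ω, ω - 1, -1, -ω, 1 - ω.
residue-sum-coordinates : ∀ (t : ℕ → ℤ) → ∑E (λ k → ⟨ t k ⟩ *E ω ^ⁿ k) (upTo 6)
  ≡ (t 0 ℤ.- t 2 ℤ.- t 3 ℤ.+ t 5 , t 1 ℤ.+ t 2 ℤ.- t 4 ℤ.- t 5)
residue-sum-coordinates t = cong₂ _,_ (first (t 0) (t 1) (t 2) (t 3) (t 4) (t 5)) (second (t 0) (t 1) (t 2) (t 3) (t 4) (t 5))
  where
  -1ℤ = -[1+ 0 ]
  first : ∀ t₀ t₁ t₂ t₃ t₄ t₅ →
    (t₀ ℤ.* + 1 ℤ.- + 0 ℤ.* + 0) ℤ.+ ((t₁ ℤ.* + 0 ℤ.- + 0 ℤ.* + 1) ℤ.+ ((t₂ ℤ.* -1ℤ ℤ.- + 0 ℤ.* + 1)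
      ℤ.+ ((t₃ ℤ.* -1ℤ ℤ.- + 0 ℤ.* + 0) ℤ.+ ((t₄ ℤ.* + 0 ℤ.- + 0 ℤ.* -1ℤ) ℤ.+ ((t₅ ℤ.* + 1 ℤ.- + 0 ℤ.* -1ℤ) ℤ.+ + 0)))))
    ≡ t₀ ℤ.- t₂ ℤ.- t₃ ℤ.+ t₅
  first = solve-∀
  second : ∀ t₀ t₁ t₂ t₃ t₄ t₅ →
    (t₀ ℤ.* + 0 ℤ.+ + 0 ℤ.* + 1 ℤ.+ + 0 ℤ.* + 0) ℤ.+ ((t₁ ℤ.* + 1 ℤ.+ + 0 ℤ.* + 0 ℤ.+ + 0 ℤ.* + 1)
      ℤ.+ ((t₂ ℤ.* + 1 ℤ.+ + 0 ℤ.* -1ℤ ℤ.+ + 0 ℤ.* + 1) ℤ.+ ((t₃ ℤ.* + 0 ℤ.+ + 0 ℤ.* -1ℤ ℤ.+ + 0 ℤ.* + 0)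
      ℤ.+ ((t₄ ℤ.* -1ℤ ℤ.+ + 0 ℤ.* + 0 ℤ.+ + 0 ℤ.* -1ℤ) ℤ.+ ((t₅ ℤ.* -1ℤ ℤ.+ + 0 ℤ.* + 1 ℤ.+ + 0 ℤ.* -1ℤ) ℤ.+ + 0)))))
    ≡ t₁ ℤ.+ t₂ ℤ.- t₄ ℤ.- t₅
  second = solve-∀

-- ρ² = -3, so ρ^{2h} = (-3)^h and ρ^{2h+1} = (-3)^h ρ = -(-3)^h + 2(-3)^h ω.
ρ^-even : ∀ h → ρ ^ⁿ (2 * h) ≡ ⟨ -[1+ 2 ] ℤ.^ h ⟩
ρ^-even h = trans (cong (ρ ^ⁿ_) (ℕP.*-comm 2 h)) (trans (𝔼Σ.^ⁿ-* ρ h 2) (⟨⟩-^ⁿ -[1+ 2 ] h))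

ρ^-odd : ∀ h → ρ ^ⁿ (1 + 2 * h) ≡ (ℤ.- (-[1+ 2 ] ℤ.^ h) , + 2 ℤ.* -[1+ 2 ] ℤ.^ h)
ρ^-odd h = trans (cong (ρ *E_) (ρ^-even h)) (cong₂ _,_ (first (-[1+ 2 ] ℤ.^ h)) (second (-[1+ 2 ] ℤ.^ h)))
  where
  first : ∀ a → -[1+ 0 ] ℤ.* a ℤ.- + 2 ℤ.* + 0 ≡ ℤ.- a
  first = solve-∀
  second : ∀ a → -[1+ 0 ] ℤ.* + 0 ℤ.+ + 2 ℤ.* a ℤ.+ + 2 ℤ.* + 0 ≡ + 2 ℤ.* a
  second = solve-∀

-- The combinations in the corollary, in terms of the coordinates X = t₀ - t₂ - t₃ + t₅ and
-- Y = t₁ + t₂ - t₄ - t₅: they are X + Y and 2X + Y.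
coordinate-sum : ∀ t₀ t₁ t₂ t₃ t₄ t₅ →
  t₀ ℤ.+ t₁ ℤ.- t₃ ℤ.- t₄ ≡ (t₀ ℤ.- t₂ ℤ.- t₃ ℤ.+ t₅) ℤ.+ (t₁ ℤ.+ t₂ ℤ.- t₄ ℤ.- t₅)
coordinate-sum = solve-∀

coordinate-twice-sum : ∀ t₀ t₁ t₂ t₃ t₄ t₅ → + 2 ℤ.* t₀ ℤ.+ t₁ ℤ.- t₂ ℤ.- + 2 ℤ.* t₃ ℤ.- t₄ ℤ.+ t₅
                       ≡ + 2 ℤ.* (t₀ ℤ.- t₂ ℤ.- t₃ ℤ.+ t₅) ℤ.+ (t₁ ℤ.+ t₂ ℤ.- t₄ ℤ.- t₅)
coordinate-twice-sum = solve-∀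

module MainIdentity {m n : ℕ} (G : Matrix m n) where
  open RowSpaceSums 𝔼-semiring G using (K; coset-sum)

  L : List (Bits n)
  L = allFuns n

  related : Bits n → Bits n → Bool
  related x y = inRowSpace G (λ e → x e xor y e)

  weight : Bits n → Bits n → Bits n → ℕ
  weight f₁ f₂ f₃ = suppSize f₁ + suppSize f₂ + suppSize f₃

  tail-sum : Bits n → 𝔼
  tail-sum f₁ = ∑E (λ f₂ → ∑E (λ f₃ → [ related f₁ f₂ ∧ related f₂ f₃ ]E *E ω ^ⁿ weight f₁ f₂ f₃) L) L

  eisensteinSum : 𝔼
  eisensteinSum = ∑E tail-sum L

  collapse-tail : ∀ f₁ → K *E (K *E tail-sum f₁)
    ≡ ∑E (λ c₁ → ∑E (λ c₂ → ω ^ⁿ tripleWeight f₁ (rowComb G c₁) (rowComb G c₂)) (allFuns m)) (allFuns m)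
  collapse-tail f₁ = begin
      K *E (K *E ∑E (λ f₂ → ∑E (λ f₃ → [ related f₁ f₂ ∧ related f₂ f₃ ]E *E W f₂ f₃) L) L)
        ≡⟨ cong (λ t → K *E (K *E t)) (𝔼Σ.sum-cong factor-first L) ⟩
      K *E (K *E ∑E (λ f₂ → [ related f₁ f₂ ]E *E inner f₂) L)
        ≡⟨ cong (K *E_) (sym (𝔼Σ.sum-*ˡ K (λ f₂ → [ related f₁ f₂ ]E *E inner f₂) L)) ⟩
      K *E ∑E (λ f₂ → K *E ([ related f₁ f₂ ]E *E inner f₂)) L
        ≡⟨ cong (K *E_) (𝔼Σ.sum-cong (λ f₂ → trans (𝔼Σ.*-swapˡ K [ related f₁ f₂ ]E (inner f₂))
                                                 (cong ([ related f₁ f₂ ]E *E_) (coset-sum f₂ (W f₂) (W-resp f₂)))) L) ⟩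
      K *E ∑E (λ f₂ → [ related f₁ f₂ ]E *E H f₂) L
        ≡⟨ coset-sum f₁ H H-resp ⟩
      ∑E (λ c₁ → H (λ e → f₁ e xor rowComb G c₁ e)) (allFuns m) ∎
    where
    open ≡-Reasoning
    W : Bits n → Bits n → 𝔼
    W f₂ f₃ = ω ^ⁿ weight f₁ f₂ f₃
    W-resp : ∀ f₂ → Resp (W f₂)
    W-resp f₂ eq = cong (λ t → ω ^ⁿ (suppSize f₁ + suppSize f₂ + t)) (suppSize-cong eq)
    inner : Bits n → 𝔼
    inner f₂ = ∑E (λ f₃ → [ related f₂ f₃ ]E *E W f₂ f₃) L
    factor-first : ∀ f₂ → ∑E (λ f₃ → [ related f₁ f₂ ∧ related f₂ f₃ ]E *E W f₂ f₃) L ≡ [ related f₁ f₂ ]E *E inner f₂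
    factor-first f₂ = trans (𝔼Σ.sum-cong (λ f₃ → trans (cong (_*E W f₂ f₃) (𝔼Σ.[∧] (related f₁ f₂) (related f₂ f₃)))
                                                       (𝔼Σ.*-assoc [ related f₁ f₂ ]E [ related f₂ f₃ ]E (W f₂ f₃))) L)
                            (𝔼Σ.sum-*ˡ [ related f₁ f₂ ]E (λ f₃ → [ related f₂ f₃ ]E *E W f₂ f₃) L)
    H : Bits n → 𝔼
    H f₂ = ∑E (λ c₂ → W f₂ (λ e → f₂ e xor rowComb G c₂ e)) (allFuns m)
    H-resp : Resp H
    H-resp eq = 𝔼Σ.sum-cong (λ c₂ → cong₂ (λ a b → ω ^ⁿ (suppSize f₁ + a + b)) (suppSize-cong eq)
                              (suppSize-cong (λ e → cong (_xor rowComb G c₂ e) (eq e)))) (allFuns m)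

  K²S : K *E (K *E eisensteinSum) ≡ ⟨ coverCount G ⟩ *E ρ ^ⁿ n
  K²S = begin
      K *E (K *E ∑E tail-sum L)
        ≡⟨ cong (K *E_) (sym (𝔼Σ.sum-*ˡ K tail-sum L)) ⟩
      K *E ∑E (λ f₁ → K *E tail-sum f₁) L
        ≡⟨ sym (𝔼Σ.sum-*ˡ K (λ f₁ → K *E tail-sum f₁) L) ⟩
      ∑E (λ f₁ → K *E (K *E tail-sum f₁)) L
        ≡⟨ 𝔼Σ.sum-cong collapse-tail L ⟩
      ∑E (λ f₁ → ∑E (λ c₁ → ∑E (λ c₂ → Φ f₁ c₁ c₂) M) M) L
        ≡⟨ 𝔼Σ.sum-swap (λ f₁ c₁ → ∑E (λ c₂ → Φ f₁ c₁ c₂) M) L M ⟩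
      ∑E (λ c₁ → ∑E (λ f₁ → ∑E (λ c₂ → Φ f₁ c₁ c₂) M) L) M
        ≡⟨ 𝔼Σ.sum-cong (λ c₁ → 𝔼Σ.sum-swap (λ f₁ c₂ → Φ f₁ c₁ c₂) L M) M ⟩
      ∑E (λ c₁ → ∑E (λ c₂ → ∑E (λ f₁ → Φ f₁ c₁ c₂) L) M) M
        ≡⟨ 𝔼Σ.sum-cong (λ c₁ → 𝔼Σ.sum-cong (λ c₂ → weight-sum (rowComb G c₁) (rowComb G c₂)) M) M ⟩
      ∑E (λ c₁ → ∑E (λ c₂ → [ covers c₁ c₂ ]E *E ρ ^ⁿ n) M) M
        ≡⟨ 𝔼Σ.sum-cong (λ c₁ → 𝔼Σ.sum-*ʳ (ρ ^ⁿ n) (λ c₂ → [ covers c₁ c₂ ]E) M) M ⟩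
      ∑E (λ c₁ → ∑E (λ c₂ → [ covers c₁ c₂ ]E) M *E ρ ^ⁿ n) M
        ≡⟨ 𝔼Σ.sum-*ʳ (ρ ^ⁿ n) (λ c₁ → ∑E (λ c₂ → [ covers c₁ c₂ ]E) M) M ⟩
      ∑E (λ c₁ → ∑E (λ c₂ → [ covers c₁ c₂ ]E) M) M *E ρ ^ⁿ n
        ≡⟨ cong (_*E ρ ^ⁿ n) as-integer ⟩
      ⟨ coverCount G ⟩ *E ρ ^ⁿ n ∎
    where
    open ≡-Reasoning
    M = allFuns m
    Φ : Bits n → Bits m → Bits m → 𝔼
    Φ f₁ c₁ c₂ = ω ^ⁿ tripleWeight f₁ (rowComb G c₁) (rowComb G c₂)
    covers : Bits m → Bits m → Bool
    covers c₁ c₂ = cover (rowComb G c₁) (rowComb G c₂)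
    as-integer : ∑E (λ c₁ → ∑E (λ c₂ → [ covers c₁ c₂ ]E) M) M ≡ ⟨ coverCount G ⟩
    as-integer = trans (𝔼Σ.sum-cong (λ c₁ → trans (𝔼Σ.sum-cong (λ c₂ → ⟨⟩-[] (covers c₁ c₂)) M)
                                                 (⟨⟩-sum (λ c₂ → [ covers c₁ c₂ ]ℤ) M)) M)
                       (⟨⟩-sum (λ c₁ → ∑ℤ (λ c₂ → [ covers c₁ c₂ ]ℤ) M) M)

  K-value : K ≡ ⟨ + (2 ^ (m ∸ rank G)) ⟩
  K-value = trans (sym (trans (⟨⟩-sumℕ _ (allFuns m))
                             (𝔼Σ.sum-cong (λ c → ⟨⟩-indicator (isZero (rowComb G c))) (allFuns m))))
                  (cong (λ w → ⟨ + w ⟩) (proj₂ (power-cofactor (rank G) (vanishCount G E) m (rk-vanishCount G E))))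
    where
    E : Bits n
    E _ = true

  eisenstein-identity : eisensteinSum ≡ ⟨ χ G (+ 4) ⟩ *E ρ ^ⁿ n
  eisenstein-identity = ⟨⟩-cancel (+ 4^d) {{ℕP.m^n≢0 4 d}} eisensteinSum (⟨ χ G (+ 4) ⟩ *E ρ ^ⁿ n) (begin
      ⟨ + 4^d ⟩ *E eisensteinSum
        ≡⟨ cong (_*E eisensteinSum) (sym (trans (⟨⟩-* k k) (cong ⟨_⟩ k²))) ⟩
      (⟨ k ⟩ *E ⟨ k ⟩) *E eisensteinSum
        ≡⟨ 𝔼Σ.*-assoc ⟨ k ⟩ ⟨ k ⟩ eisensteinSum ⟩
      ⟨ k ⟩ *E (⟨ k ⟩ *E eisensteinSum)
        ≡⟨ cong (λ z → z *E (z *E eisensteinSum)) (sym K-value) ⟩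
      K *E (K *E eisensteinSum)
        ≡⟨ K²S ⟩
      ⟨ coverCount G ⟩ *E ρ ^ⁿ n
        ≡⟨ cong (λ z → ⟨ z ⟩ *E ρ ^ⁿ n) (coverCount-χ G) ⟩
      ⟨ + 4^d ℤ.* χ G (+ 4) ⟩ *E ρ ^ⁿ n
        ≡⟨ cong (_*E ρ ^ⁿ n) (sym (⟨⟩-* (+ 4^d) (χ G (+ 4)))) ⟩
      (⟨ + 4^d ⟩ *E ⟨ χ G (+ 4) ⟩) *E ρ ^ⁿ n
        ≡⟨ 𝔼Σ.*-assoc ⟨ + 4^d ⟩ ⟨ χ G (+ 4) ⟩ (ρ ^ⁿ n) ⟩
      ⟨ + 4^d ⟩ *E (⟨ χ G (+ 4) ⟩ *E ρ ^ⁿ n) ∎)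
    where
    open ≡-Reasoning
    d = m ∸ rank G
    4^d = 4 ^ d
    k = + (2 ^ d)
    k² : k ℤ.* k ≡ + 4^d
    k² = trans (sym (ℤP.pos-* (2 ^ d) (2 ^ d))) (cong +_ (square-of-power-of-two d))

  -- S = Σ_{k < 6} T_k ω^k: split each ω^w according to w mod 6 and exchange the sums.
  eisensteinSum-by-T : eisensteinSum ≡ ∑E (λ k → ⟨ Tℤ G k ⟩ *E ω ^ⁿ k) (upTo 6)
  eisensteinSum-by-T = begin
      ∑³ (λ f₁ f₂ f₃ → [ related f₁ f₂ ∧ related f₂ f₃ ]E *E ω ^ⁿ weight f₁ f₂ f₃)
        ≡⟨ ∑³-cong by-residue ⟩
      ∑³ (λ f₁ f₂ f₃ → ∑E (λ k → [ inT G k f₁ f₂ f₃ ]E *E ω ^ⁿ k) six)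
        ≡⟨ ∑³-swap (λ f₁ f₂ f₃ k → [ inT G k f₁ f₂ f₃ ]E *E ω ^ⁿ k) ⟩
      ∑E (λ k → ∑³ (λ f₁ f₂ f₃ → [ inT G k f₁ f₂ f₃ ]E *E ω ^ⁿ k)) six
        ≡⟨ 𝔼Σ.sum-cong (λ k → ∑³-*ʳ (λ f₁ f₂ f₃ → [ inT G k f₁ f₂ f₃ ]E) (ω ^ⁿ k)) six ⟩
      ∑E (λ k → ∑³ (λ f₁ f₂ f₃ → [ inT G k f₁ f₂ f₃ ]E) *E ω ^ⁿ k) six
        ≡⟨ 𝔼Σ.sum-cong (λ k → cong (_*E ω ^ⁿ k) (sym (count k))) six ⟩
      ∑E (λ k → ⟨ Tℤ G k ⟩ *E ω ^ⁿ k) six ∎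
    where
    open ≡-Reasoning
    six = upTo 6
    ∑³ : (Bits n → Bits n → Bits n → 𝔼) → 𝔼
    ∑³ φ = ∑E (λ f₁ → ∑E (λ f₂ → ∑E (λ f₃ → φ f₁ f₂ f₃) L) L) L
    ∑³-cong : ∀ {φ ψ} → (∀ a b c → φ a b c ≡ ψ a b c) → ∑³ φ ≡ ∑³ ψ
    ∑³-cong h = 𝔼Σ.sum-cong (λ a → 𝔼Σ.sum-cong (λ b → 𝔼Σ.sum-cong (h a b) L) L) L
    ∑³-swap : ∀ (φ : Bits n → Bits n → Bits n → ℕ → 𝔼) →
      ∑³ (λ a b c → ∑E (φ a b c) six) ≡ ∑E (λ k → ∑³ (λ a b c → φ a b c k)) six
    ∑³-swap φ = trans (𝔼Σ.sum-cong (λ a → trans (𝔼Σ.sum-cong (λ b → 𝔼Σ.sum-swap (φ a b) L six) L)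
                                                (𝔼Σ.sum-swap (λ b k → ∑E (λ c → φ a b c k) L) L six)) L)
                      (𝔼Σ.sum-swap (λ a k → ∑E (λ b → ∑E (λ c → φ a b c k) L) L) L six)
    ∑³-*ʳ : ∀ φ t → ∑³ (λ a b c → φ a b c *E t) ≡ ∑³ φ *E t
    ∑³-*ʳ φ t = trans (𝔼Σ.sum-cong (λ a → trans (𝔼Σ.sum-cong (λ b → 𝔼Σ.sum-*ʳ t (φ a b) L) L)
                                                (𝔼Σ.sum-*ʳ t (λ b → ∑E (φ a b) L) L)) L)
                      (𝔼Σ.sum-*ʳ t (λ a → ∑E (λ b → ∑E (φ a b) L) L) L)
    by-residue : ∀ f₁ f₂ f₃ → [ related f₁ f₂ ∧ related f₂ f₃ ]E *E ω ^ⁿ weight f₁ f₂ f₃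
                              ≡ ∑E (λ k → [ inT G k f₁ f₂ f₃ ]E *E ω ^ⁿ k) six
    by-residue f₁ f₂ f₃ = trans (cong ([ a ∧ b ]E *E_) (ω^-by-residue (weight f₁ f₂ f₃)))
                            (trans (sym (𝔼Σ.sum-*ˡ [ a ∧ b ]E (λ k → [ residue k ]E *E ω ^ⁿ k) six))
                                   (𝔼Σ.sum-cong (λ k → merge (residue k) (ω ^ⁿ k)) six))
      where
      a = related f₁ f₂
      b = related f₂ f₃
      residue : ℕ → Bool
      residue k = (weight f₁ f₂ f₃ % 6) ≡ᵇ k
      merge : ∀ c x → [ a ∧ b ]E *E ([ c ]E *E x) ≡ [ a ∧ (b ∧ c) ]E *E x
      merge c x = sym (trans (cong (λ t → [ t ]E *E x) (sym (∧-assoc a b c)))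
                             (trans (cong (_*E x) (𝔼Σ.[∧] (a ∧ b) c)) (𝔼Σ.*-assoc [ a ∧ b ]E [ c ]E x)))
    count : ∀ k → ⟨ Tℤ G k ⟩ ≡ ∑³ (λ f₁ f₂ f₃ → [ inT G k f₁ f₂ f₃ ]E)
    count k = trans (⟨⟩-sumℕ _ L) (𝔼Σ.sum-cong (λ f₁ → trans (⟨⟩-sumℕ _ L) (𝔼Σ.sum-cong (λ f₂ →
                trans (⟨⟩-sumℕ _ L) (𝔼Σ.sum-cong (λ f₃ → ⟨⟩-indicator (inT G k f₁ f₂ f₃)) L)) L)) L)

  T-coordinates : (Tℤ G 0 ℤ.- Tℤ G 2 ℤ.- Tℤ G 3 ℤ.+ Tℤ G 5 , Tℤ G 1 ℤ.+ Tℤ G 2 ℤ.- Tℤ G 4 ℤ.- Tℤ G 5)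
                  ≡ ⟨ χ G (+ 4) ⟩ *E ρ ^ⁿ n
  T-coordinates = trans (sym (residue-sum-coordinates (Tℤ G))) (trans (sym eisensteinSum-by-T) eisenstein-identity)

  -- n = 2h: ρⁿ = (-3)^h, so X = (-3)^h χ and Y = 0.
  even-case : ∀ (h : ℕ) → n ≡ 2 * h →
    ((Tℤ G 0 ℤ.+ Tℤ G 1 ℤ.- Tℤ G 3 ℤ.- Tℤ G 4) ≡ (-[1+ 2 ] ℤ.^ h) ℤ.* χ G (+ 4))
    × ((Tℤ G 1 ℤ.+ Tℤ G 2 ℤ.- Tℤ G 4 ℤ.- Tℤ G 5) ≡ + 0)
  even-case h n≡2h =
      trans (coordinate-sum t₀ t₁ t₂ t₃ t₄ t₅)
            (trans (cong₂ ℤ._+_ (cong proj₁ coords) (cong proj₂ coords)) (conclude (χ G (+ 4)) a)) ,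
      cong proj₂ coords
    where
    t₀ = Tℤ G 0 ; t₁ = Tℤ G 1 ; t₂ = Tℤ G 2 ; t₃ = Tℤ G 3 ; t₄ = Tℤ G 4 ; t₅ = Tℤ G 5
    a = -[1+ 2 ] ℤ.^ h
    coords : (t₀ ℤ.- t₂ ℤ.- t₃ ℤ.+ t₅ , t₁ ℤ.+ t₂ ℤ.- t₄ ℤ.- t₅) ≡ ⟨ χ G (+ 4) ℤ.* a ⟩
    coords = trans T-coordinates (trans (cong (λ p → ⟨ χ G (+ 4) ⟩ *E ρ ^ⁿ p) n≡2h)
                                        (trans (cong (⟨ χ G (+ 4) ⟩ *E_) (ρ^-even h)) (⟨⟩-* (χ G (+ 4)) a)))
    conclude : ∀ c a → c ℤ.* a ℤ.+ + 0 ≡ a ℤ.* c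
    conclude = solve-∀

  -- n = 2h + 1: ρⁿ = -(-3)^h + 2(-3)^h ω, so X = -(-3)^h χ and Y = 2(-3)^h χ.
  odd-case : ∀ (h : ℕ) → n ≡ 1 + 2 * h →
    ((Tℤ G 1 ℤ.+ Tℤ G 2 ℤ.- Tℤ G 4 ℤ.- Tℤ G 5) ≡ + 2 ℤ.* (Tℤ G 0 ℤ.+ Tℤ G 1 ℤ.- Tℤ G 3 ℤ.- Tℤ G 4))
    × ((Tℤ G 0 ℤ.+ Tℤ G 1 ℤ.- Tℤ G 3 ℤ.- Tℤ G 4) ≡ (-[1+ 2 ] ℤ.^ h) ℤ.* χ G (+ 4))
    × ((+ 2 ℤ.* Tℤ G 0 ℤ.+ Tℤ G 1 ℤ.- Tℤ G 2 ℤ.- + 2 ℤ.* Tℤ G 3 ℤ.- Tℤ G 4 ℤ.+ Tℤ G 5) ≡ + 0)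
  odd-case h n≡1+2h =
      trans (cong proj₂ coords) (trans (twice (χ G (+ 4)) a) (cong (+ 2 ℤ.*_) (sym sum))) ,
      trans sum (total (χ G (+ 4)) a) ,
      trans (coordinate-twice-sum t₀ t₁ t₂ t₃ t₄ t₅)
            (trans (cong₂ (λ x y → + 2 ℤ.* x ℤ.+ y) (cong proj₁ coords) (cong proj₂ coords)) (vanishing (χ G (+ 4)) a))
    where
    t₀ = Tℤ G 0 ; t₁ = Tℤ G 1 ; t₂ = Tℤ G 2 ; t₃ = Tℤ G 3 ; t₄ = Tℤ G 4 ; t₅ = Tℤ G 5
    a = -[1+ 2 ] ℤ.^ h
    coords : (t₀ ℤ.- t₂ ℤ.- t₃ ℤ.+ t₅ , t₁ ℤ.+ t₂ ℤ.- t₄ ℤ.- t₅) ≡ (χ G (+ 4) ℤ.* ℤ.- a , χ G (+ 4) ℤ.* (+ 2 ℤ.* a))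
    coords = trans T-coordinates (trans (cong (λ p → ⟨ χ G (+ 4) ⟩ *E ρ ^ⁿ p) n≡1+2h)
                                        (trans (cong (⟨ χ G (+ 4) ⟩ *E_) (ρ^-odd h)) (scale (χ G (+ 4)) (ℤ.- a) (+ 2 ℤ.* a))))
    sum : t₀ ℤ.+ t₁ ℤ.- t₃ ℤ.- t₄ ≡ χ G (+ 4) ℤ.* ℤ.- a ℤ.+ χ G (+ 4) ℤ.* (+ 2 ℤ.* a)
    sum = trans (coordinate-sum t₀ t₁ t₂ t₃ t₄ t₅) (cong₂ ℤ._+_ (cong proj₁ coords) (cong proj₂ coords))
    twice : ∀ c a → c ℤ.* (+ 2 ℤ.* a) ≡ + 2 ℤ.* (c ℤ.* ℤ.- a ℤ.+ c ℤ.* (+ 2 ℤ.* a))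
    twice = solve-∀
    total : ∀ c a → c ℤ.* ℤ.- a ℤ.+ c ℤ.* (+ 2 ℤ.* a) ≡ a ℤ.* c
    total = solve-∀
    vanishing : ∀ c a → + 2 ℤ.* (c ℤ.* ℤ.- a) ℤ.+ c ℤ.* (+ 2 ℤ.* a) ≡ + 0
    vanishing = solve-∀

corollary5p5 : ∀ {m n} (G : Matrix m n) →
    (∀ (h : ℕ) → n ≡ 2 * h →
        ((Tℤ G 0 ℤ.+ Tℤ G 1 ℤ.- Tℤ G 3 ℤ.- Tℤ G 4) ≡ (-[1+ 2 ] ℤ.^ h) ℤ.* χ G (+ 4))
      × ((Tℤ G 1 ℤ.+ Tℤ G 2 ℤ.- Tℤ G 4 ℤ.- Tℤ G 5) ≡ + 0))
  × (∀ (h : ℕ) → n ≡ 1 + 2 * h →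
        ((Tℤ G 1 ℤ.+ Tℤ G 2 ℤ.- Tℤ G 4 ℤ.- Tℤ G 5) ≡ + 2 ℤ.* (Tℤ G 0 ℤ.+ Tℤ G 1 ℤ.- Tℤ G 3 ℤ.- Tℤ G 4))
      × ((Tℤ G 0 ℤ.+ Tℤ G 1 ℤ.- Tℤ G 3 ℤ.- Tℤ G 4) ≡ (-[1+ 2 ] ℤ.^ h) ℤ.* χ G (+ 4))
      × ((+ 2 ℤ.* Tℤ G 0 ℤ.+ Tℤ G 1 ℤ.- Tℤ G 2 ℤ.- + 2 ℤ.* Tℤ G 3 ℤ.- Tℤ G 4 ℤ.+ Tℤ G 5) ≡ + 0))
corollary5p5 G = MainIdentity.even-case G , MainIdentity.odd-case G
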